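{- The summation \[ S(U^m_n) = \displaystyle \sum_{I,L} (-1)^{n-|L|+1} U^{|I|}_I \oplus U^{m-|I|}_L \] holds and is cancellation free, where $I,L$ ranges over all pairs of subsets of $E$ such that \begin{itemize} \item $I$ and $L$ are disjoint, \item $|I|<m$, \item $|I|+|L|\geq m$, and \item if $|I|+|L|=m$ then $|L|=1$ and $e_i < e_\ell$ for all $e_i \in I$, where $e_\ell$ is the unique element of $L$. \end{itemize}
   Context: Fix a field $k$. Work in the restriction-contraction Hopf algebra $k\widetilde{\mathcal{M}}$ of (isomorphism classes of) matroids in a class $\mathcal{M}$ closed under direct sums and minors containing the uniform matroids (e.g. partition matroids), with product the direct sum $\oplus$, coproduct $\Delta(M) = \sum_{A \subseteq E} M|_A \otimes M/A$, and antipode $S$. $U^m_n$ is the uniform matroid of rank $m$ on an $n$-element ground set $E$, and $U^t_X$ denotes the uniform matroid of rank $t$ with ground set $X$. A total order $<$ on $E$ is fixed. -}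

module Defs where

open import Level using (_⊔_)
open import Data.Nat using (ℕ; zero; suc; _+_; _∸_; _⊓_; _<_; _≤_)
import Data.Nat as ℕ
open import Data.Nat.Properties using (_<?_; _≤?_)
open import Data.Integer using (ℤ) renaming (+_ to ⁺_; -_ to ℤ-)
open import Data.Fin using (Fin) renaming (_<_ to _<ᶠ_)
open import Data.Fin.Properties using (all?) renaming (_<?_ to _<ᶠ?_)
open import Data.Fin.Subset using (Subset; inside; outside; _∪_; _∩_; _─_; ∣_∣; _⊆_; _⊂_; _∈_; _∉_; ⊤)
open import Data.Fin.Subset.Properties using (_⊂?_; _∈?_)
open import Data.Fin.Permutation using (Permutation′; _⟨$⟩ˡ_)
open import Data.Vec using (Vec; []; _∷_; tabulate; lookup)
open import Data.List using (List; []; _∷_; map; concatMap; filter; _++_; cartesianProduct)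
open import Data.Product using (Σ; _×_; _,_; proj₁; proj₂; uncurry)
open import Relation.Nullary using (Dec; yes; no; ¬_)
open import Relation.Nullary.Decidable using (_×-dec_; _→-dec_; ¬?)
open import Relation.Binary.PropositionalEquality using (_≡_)
open import Algebra.Apartness.Bundles using (HeytingField)

-- A matroid is given by its ground set X and its rank function; only
-- the values of `rank` on subsets of X are meaningful (all operations
-- below only ever evaluate `rank` on subsets of the ground set).

record Matroid (n : ℕ) : Set where
  constructor mat
  field
    ground : Subset n
    rank   : Subset n → ℕ

open Matroid public

module _ {n : ℕ} where

  U : ℕ → Subset n → Matroid n
  U t X = mat X (λ Y → t ⊓ ∣ Y ∩ X ∣)

  _∣ʳ_ : Matroid n → Subset n → Matroid n
  M ∣ʳ A = mat A (λ Y → rank M (Y ∩ A))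

  _/_ : Matroid n → Subset n → Matroid n
  M / A = mat (ground M ─ A) (λ Y → rank M ((Y ∩ (ground M ─ A)) ∪ A) ∸ rank M A)

  _⊕_ : Matroid n → Matroid n → Matroid n
  M ⊕ N = mat (ground M ∪ ground N)
              (λ Y → rank M (Y ∩ ground M) + rank N (Y ∩ ground N))

  image : Permutation′ n → Subset n → Subset n
  image σ Y = tabulate (λ j → lookup Y (σ ⟨$⟩ˡ j))

  -- matroid isomorphism: a bijection of ground sets preserving rank
  -- (any bijection between subsets of Fin n extends to a permutation)
  _≅_ : Matroid n → Matroid n → Set
  M ≅ N = Σ (Permutation′ n) λ σ →
            (image σ (ground M) ≡ ground N)
          × (∀ Y → Y ⊆ ground M → rank N (image σ Y) ≡ rank M Y)

allSubsets : (n : ℕ) → List (Subset n)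
allSubsets zero = [] ∷ []
allSubsets (suc n) = map (outside ∷_) (allSubsets n) ++ map (inside ∷_) (allSubsets n)

properSubsets : {n : ℕ} → Subset n → List (Subset n)
properSubsets {n} X = filter (λ A → A ⊂? X) (allSubsets n)

-- The restriction-contraction Hopf algebra over a field K, restricted to
-- matroids on subsets of Fin n (enough for everything graded ≤ n).

module Over {c ℓ₁ ℓ₂} (K : HeytingField c ℓ₁ ℓ₂) (n : ℕ) where
  open HeytingField K using (Carrier; _≈_; 0#; 1#; -_) renaming (_+_ to _+ₖ_)

  Comb : Set c
  Comb = List (Carrier × Matroid n)

  -- equality in the free K-module on isomorphism classes of matroids:
  -- the congruence generated by reordering, replacing a term by an
  -- isomorphic matroid / equal coefficient, merging like terms and
  -- dropping zero terms.
  infix 4 _≋_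
  data _≋_ : Comb → Comb → Set (c ⊔ ℓ₁) where
    ≋-refl  : ∀ {x} → x ≋ x
    ≋-sym   : ∀ {x y} → x ≋ y → y ≋ x
    ≋-trans : ∀ {x y z} → x ≋ y → y ≋ z → x ≋ z
    ≋-cons  : ∀ t {x y} → x ≋ y → (t ∷ x) ≋ (t ∷ y)
    ≋-swap  : ∀ s t x → (s ∷ t ∷ x) ≋ (t ∷ s ∷ x)
    ≋-term  : ∀ {a b M N} x → a ≈ b → M ≅ N → ((a , M) ∷ x) ≋ ((b , N) ∷ x)
    ≋-merge : ∀ a b M x → ((a , M) ∷ (b , M) ∷ x) ≋ ((a +ₖ b , M) ∷ x)
    ≋-zero  : ∀ M x → ((0# , M) ∷ x) ≋ x

  negC : Comb → Comb
  negC = map (λ t → (- proj₁ t , proj₂ t))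

  _⊕ᶜ_ : Comb → Matroid n → Comb
  x ⊕ᶜ N = map (λ t → (proj₁ t , proj₂ t ⊕ N)) x

  -- Antipode via the defining relation  Σ_A S(M|A) ⊕ M/A = ε(M):
  --   S(M) = 1 (the empty matroid)      if the ground set is empty,
  --   S(M) = - Σ_{A ⊊ E} S(M|A) ⊕ M/A   otherwise.
  -- The first argument is fuel (recursion on |ground|); fuel suc n suffices.
  antipodeF : ℕ → Matroid n → Comb
  antipodeF zero M = []
  antipodeF (suc f) M with ∣ ground M ∣ ℕ.≟ 0
  ... | yes _ = (1# , M) ∷ []
  ... | no _  = negC (concatMap (λ A → antipodeF f (M ∣ʳ A) ⊕ᶜ (M / A))
                                (properSubsets (ground M)))

  S : Matroid n → Comb
  S = antipodeF (suc n)

  sgn : ℕ → Carrier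
  sgn zero = 1#
  sgn (suc k) = - sgn k

-- The index set and terms of the summation (ground set E = Fin n,
-- total order = the usual order on Fin n).

module _ {n : ℕ} where

  Disjoint : Subset n → Subset n → Set
  Disjoint I L = ∀ i → i ∈ I → i ∉ L

  Valid : ℕ → Subset n → Subset n → Set
  Valid m I L = Disjoint I L
              × ∣ I ∣ < m
              × m ≤ ∣ I ∣ + ∣ L ∣
              × (∣ I ∣ + ∣ L ∣ ≡ m →
                   (∣ L ∣ ≡ 1) × (∀ i l → i ∈ I → l ∈ L → i <ᶠ l))

  valid? : (m : ℕ) (I L : Subset n) → Dec (Valid m I L)
  valid? m I L =
    all? (λ i → (i ∈? I) →-dec (¬? (i ∈? L)))
    ×-dec (∣ I ∣ <? m)
    ×-dec (m ≤? ∣ I ∣ + ∣ L ∣)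
    ×-dec ((∣ I ∣ + ∣ L ∣ ℕ.≟ m) →-dec
             ((∣ L ∣ ℕ.≟ 1) ×-dec
               all? (λ i → all? (λ l →
                 (i ∈? I) →-dec ((l ∈? L) →-dec (i <ᶠ? l))))))

  validPairs : ℕ → List (Subset n × Subset n)
  validPairs m = filter (λ p → valid? m (proj₁ p) (proj₂ p))
                        (cartesianProduct (allSubsets n) (allSubsets n))

  -- the term U^{|I|}_I ⊕ U^{m-|I|}_L, as a matroid on E: the elements of
  -- E ∖ (I ∪ L) are loops (U^0 on them), so that the term is graded n.
  term : ℕ → Subset n → Subset n → Matroid n
  term m I L = (U ∣ I ∣ I ⊕ U (m ∸ ∣ I ∣) L) ⊕ U 0 (⊤ ─ (I ∪ L))

  sgnℤ : ℕ → ℤ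
  sgnℤ zero = ⁺ 1
  sgnℤ (suc k) = ℤ- (sgnℤ k)

  sign : Subset n → ℕ
  sign L = n ∸ ∣ L ∣ + 1

  -- cancellation free: summands that are isomorphic (i.e. the same basis
  -- element of the Hopf algebra) always carry the same sign
  CancellationFree : ℕ → Set
  CancellationFree m = ∀ I L I′ L′ → Valid m I L → Valid m I′ L′ →
                         term m I L ≅ term m I′ L′ →
                         sgnℤ (sign L) ≡ sgnℤ (sign L′)

module _ {c ℓ₁ ℓ₂} (K : HeytingField c ℓ₁ ℓ₂) (n : ℕ) where
  open Over K n

  formulaSum : ℕ → Comb
  formulaSum m = map (λ p → (sgn (sign (proj₂ p)) , term m (proj₁ p) (proj₂ p)))
                     (validPairs m)

-- The antipode is computed from its defining recursion S(M) = -Σ_{A ⊊ E} S(M|A) ⊕ M/A,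
-- using U^m_X|A = U^m_A and U^m_X/A = U^{m-|A|}_{X∖A}.  By induction on |X|,
-- S(U^m_X) is (-1)^|X| U^m_X when |X| < m and the stated sum with E replaced by X
-- when |X| ≥ m.  The inductive step compares integer coefficients of the terms
-- U^{|I|}_I ⊕ U^{m-|I|}_L, labelled by pairs (I, L): a proper subset A with |A| < m
-- contributes (-1)^|A| to the pair (A, X∖A), a larger A contributes the sum for A,
-- and for a valid pair with S = I ∪ L everything collapses through
-- Σ_{S ⊆ A ⊆ X} (-1)^|A| = [S = X] (-1)^|X|.  For |X| = m, U^m_X is free, hence is
-- the single term of (X∖x, {x}) with x the largest element of X.
-- Cancellation-freeness: Σ_e r({e}) = |I| + |L| and, unless |I| + |L| = m,
-- Σ_e (m - r(E∖e)) = |I| are isomorphism invariants of the summand, so they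
-- determine |L| and hence the sign.

module Submission where

open import Defs
open import Algebra.Apartness.Bundles using (HeytingField; HeytingCommutativeRing)
open import Algebra.Bundles using (CommutativeRing)
open import Data.Bool as Bool using (Bool; true; false; _∧_; not)
import Data.Bool.Properties as BoolP
open import Data.Empty using (⊥-elim)
open import Data.Fin using (Fin; zero; suc) renaming (_<_ to _<ᶠ_)
import Data.Fin.Permutation as Perm
open import Data.Fin.Subset using (Subset; ⊤; ⊥; ⁅_⁆; _∩_; _∪_; _─_; ∣_∣; _∈_; _⊆_; _⊂_)
import Data.Fin.Subset.Properties as SubsetP
open import Data.Integer as ℤ using (ℤ; +_; -[1+_])
import Data.Integer.Properties as ℤP
open import Data.Integer.Tactic.RingSolver using (solve-∀)
open import Data.List using (List; []; _∷_; map; _++_; concatMap; filter; cartesianProduct; length)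
import Data.List.Properties as ListP
open import Data.List.Relation.Binary.Pointwise using (Pointwise; []; _∷_)
open import Data.Nat as ℕ using (ℕ; zero; suc; _<_; _≤_; z≤n; s≤s)
import Data.Nat.Properties as ℕP
open import Data.Product using (_×_; _,_; proj₁; proj₂)
open import Data.Sum using (inj₁; inj₂)
open import Data.Unit using (tt)
import Data.Unit.Properties as UnitP
open import Data.Vec using ([]; _∷_; here; there)
open import Data.Vec.Properties using (≡-dec; tabulate∘lookup)
open import Function using (_∘_)
open import Level using (_⊔_)
open import Relation.Binary.Bundles using (Setoid)
open import Relation.Binary.Definitions using (DecidableEquality)
open import Relation.Binary.PropositionalEquality
import Relation.Binary.Reasoning.Setoid
open import Relation.Nullary using (Dec; yes; no; does; ¬_; contradiction)
open import Relation.Nullary.Decidable using (dec-true; dec-false; ¬?; map′; _×-dec_)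

private variable n : ℕ

module _ where
  open import Data.Nat using (_+_)

  infix 4.5 _⊆ᵇ_ _⊂ᵇ_ _≡ᵇ_

  _⊆ᵇ_ _⊂ᵇ_ _≡ᵇ_ : Subset n → Subset n → Bool
  p ⊆ᵇ q = does (p SubsetP.⊆? q)
  p ⊂ᵇ q = does (p SubsetP.⊂? q)
  p ≡ᵇ q = does (≡-dec Bool._≟_ p q)

  disjointᵇ : Subset n → Subset n → Bool
  disjointᵇ []      []      = true
  disjointᵇ (x ∷ p) (y ∷ q) = not (x ∧ y) ∧ disjointᵇ p q

  does⇒ : ∀ {ℓ} {P : Set ℓ} (P? : Dec P) → does P? ≡ true → P
  does⇒ (yes p) _ = p

  true≢false : true ≢ false
  true≢false ()

  ∧-true⁻ : ∀ a b → a ∧ b ≡ true → a ≡ true × b ≡ true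
  ∧-true⁻ true true _ = refl , refl

  module _ (p q : Subset n) where

    ≡ᵇ⇒≡ : p ≡ᵇ q ≡ true → p ≡ q
    ≡ᵇ⇒≡ = does⇒ (≡-dec Bool._≟_ p q)

    ⊆ᵇ⇒⊆ : p ⊆ᵇ q ≡ true → p ⊆ q
    ⊆ᵇ⇒⊆ = does⇒ (p SubsetP.⊆? q)

    ⊆⇒⊆ᵇ : p ⊆ q → p ⊆ᵇ q ≡ true
    ⊆⇒⊆ᵇ = dec-true (p SubsetP.⊆? q)

    ⊂ᵇ⇒⊂ : p ⊂ᵇ q ≡ true → p ⊂ q
    ⊂ᵇ⇒⊂ = does⇒ (p SubsetP.⊂? q)

    ⊂ᵇ⇒⊆ᵇ : p ⊂ᵇ q ≡ true → p ⊆ᵇ q ≡ true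
    ⊂ᵇ⇒⊆ᵇ h = ⊆⇒⊆ᵇ (SubsetP.p⊂q⇒p⊆q (⊂ᵇ⇒⊂ h))

    ⊆ᵇ⇒∣∣≤ : p ⊆ᵇ q ≡ true → ∣ p ∣ ≤ ∣ q ∣
    ⊆ᵇ⇒∣∣≤ h = SubsetP.p⊆q⇒∣p∣≤∣q∣ (⊆ᵇ⇒⊆ h)

  ⊆ᵇ-refl : (p : Subset n) → p ⊆ᵇ p ≡ true
  ⊆ᵇ-refl p = ⊆⇒⊆ᵇ p p SubsetP.⊆-refl

  ⊆ᵇ-trans : (p q r : Subset n) → p ⊆ᵇ q ≡ true → q ⊆ᵇ r ≡ true → p ⊆ᵇ r ≡ true
  ⊆ᵇ-trans p q r h₁ h₂ = ⊆⇒⊆ᵇ p r (SubsetP.⊆-trans (⊆ᵇ⇒⊆ p q h₁) (⊆ᵇ⇒⊆ q r h₂))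

  ⊆ᵇ-⊤ : (p : Subset n) → p ⊆ᵇ ⊤ ≡ true
  ⊆ᵇ-⊤ p = ⊆⇒⊆ᵇ p ⊤ SubsetP.⊆⊤

  ⊥-⊆ᵇ : (p : Subset n) → ⊥ ⊆ᵇ p ≡ true
  ⊥-⊆ᵇ p = ⊆⇒⊆ᵇ ⊥ p SubsetP.⊥⊆

  ⊂ᵇ≡⊆ᵇ∧¬≡ᵇ : (A X : Subset n) → A ⊂ᵇ X ≡ (A ⊆ᵇ X) ∧ not (A ≡ᵇ X)
  ⊂ᵇ≡⊆ᵇ∧¬≡ᵇ []          []          = refl
  ⊂ᵇ≡⊆ᵇ∧¬≡ᵇ (false ∷ A) (false ∷ X) = ⊂ᵇ≡⊆ᵇ∧¬≡ᵇ A X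
  ⊂ᵇ≡⊆ᵇ∧¬≡ᵇ (false ∷ A) (true ∷ X)  = sym (BoolP.∧-identityʳ (A ⊆ᵇ X))
  ⊂ᵇ≡⊆ᵇ∧¬≡ᵇ (true ∷ A)  (false ∷ X) = refl
  ⊂ᵇ≡⊆ᵇ∧¬≡ᵇ (true ∷ A)  (true ∷ X)  = ⊂ᵇ≡⊆ᵇ∧¬≡ᵇ A X

  ⊆ᵇ∧∣∣<⇒⊂ᵇ : (A X : Subset n) → A ⊆ᵇ X ≡ true → ∣ A ∣ < ∣ X ∣ → A ⊂ᵇ X ≡ true
  ⊆ᵇ∧∣∣<⇒⊂ᵇ A X A⊆X |A|<|X| with A ≡ᵇ X in eq
  ... | true  = contradiction (cong ∣_∣ (≡ᵇ⇒≡ A X eq)) (ℕP.<⇒≢ |A|<|X|)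
  ... | false = trans (⊂ᵇ≡⊆ᵇ∧¬≡ᵇ A X) (cong₂ _∧_ A⊆X (cong not eq))

  X─A⊆ᵇX : (X A : Subset n) → X ─ A ⊆ᵇ X ≡ true
  X─A⊆ᵇX X A = ⊆⇒⊆ᵇ (X ─ A) X (SubsetP.p─q⊆p X A)

  ⊥≡ᵇX : (X : Subset n) → 1 ≤ ∣ X ∣ → ⊥ ≡ᵇ X ≡ false
  ⊥≡ᵇX {n} X 1≤|X| = dec-false (≡-dec Bool._≟_ ⊥ X) λ ⊥≡X →
    ℕP.<⇒≢ 1≤|X| (trans (sym (SubsetP.∣⊥∣≡0 n)) (cong ∣_∣ ⊥≡X))

  ∪-⊆ᵇ : (I L A : Subset n) → I ∪ L ⊆ᵇ A ≡ (I ⊆ᵇ A) ∧ (L ⊆ᵇ A)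
  ∪-⊆ᵇ []          []          []          = refl
  ∪-⊆ᵇ (true ∷ I)  (true ∷ L)  (true ∷ A)  = ∪-⊆ᵇ I L A
  ∪-⊆ᵇ (true ∷ I)  (false ∷ L) (true ∷ A)  = ∪-⊆ᵇ I L A
  ∪-⊆ᵇ (true ∷ I)  (l ∷ L)     (false ∷ A) = refl
  ∪-⊆ᵇ (false ∷ I) (true ∷ L)  (true ∷ A)  = ∪-⊆ᵇ I L A
  ∪-⊆ᵇ (false ∷ I) (true ∷ L)  (false ∷ A) = sym (BoolP.∧-zeroʳ (I ⊆ᵇ A))
  ∪-⊆ᵇ (false ∷ I) (false ∷ L) (true ∷ A)  = ∪-⊆ᵇ I L A
  ∪-⊆ᵇ (false ∷ I) (false ∷ L) (false ∷ A) = ∪-⊆ᵇ I L A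

  ∪-⊆ᵇ⁺ : (I L A : Subset n) → I ⊆ᵇ A ≡ true → L ⊆ᵇ A ≡ true → I ∪ L ⊆ᵇ A ≡ true
  ∪-⊆ᵇ⁺ I L A I⊆A L⊆A = trans (∪-⊆ᵇ I L A) (cong₂ _∧_ I⊆A L⊆A)

  ∪-⊆ᵇ⁻ : (I L A : Subset n) → I ∪ L ⊆ᵇ A ≡ true → I ⊆ᵇ A ≡ true × L ⊆ᵇ A ≡ true
  ∪-⊆ᵇ⁻ I L A I∪L⊆A = ∧-true⁻ (I ⊆ᵇ A) (L ⊆ᵇ A) (trans (sym (∪-⊆ᵇ I L A)) I∪L⊆A)

  ⊆ᵇ⇒∩≡ : (A X : Subset n) → A ⊆ᵇ X ≡ true → A ∩ X ≡ A
  ⊆ᵇ⇒∩≡ []          []          _ = refl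
  ⊆ᵇ⇒∩≡ (true ∷ A)  (true ∷ X)  h = cong (true ∷_) (⊆ᵇ⇒∩≡ A X h)
  ⊆ᵇ⇒∩≡ (false ∷ A) (x ∷ X)     h = cong (false ∷_) (⊆ᵇ⇒∩≡ A X h)
  ⊆ᵇ⇒∩≡ (true ∷ A)  (false ∷ X) ()

  ∩-restrictˡ : (Y A X : Subset n) → A ⊆ᵇ X ≡ true → (Y ∩ A) ∩ X ≡ Y ∩ A
  ∩-restrictˡ Y A X A⊆X = trans (SubsetP.∩-assoc Y A X) (cong (Y ∩_) (⊆ᵇ⇒∩≡ A X A⊆X))

  ∩-restrictʳ : (Y Z A : Subset n) → A ⊆ᵇ Z ≡ true → (Y ∩ Z) ∩ A ≡ Y ∩ A
  ∩-restrictʳ Y Z A A⊆Z = begin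
    (Y ∩ Z) ∩ A ≡⟨ SubsetP.∩-assoc Y Z A ⟩
    Y ∩ (Z ∩ A) ≡⟨ cong (Y ∩_) (SubsetP.∩-comm Z A) ⟩
    Y ∩ (A ∩ Z) ≡⟨ cong (Y ∩_) (⊆ᵇ⇒∩≡ A Z A⊆Z) ⟩
    Y ∩ A       ∎
    where open ≡-Reasoning

  ∩-idemʳ : (Y A : Subset n) → (Y ∩ A) ∩ A ≡ Y ∩ A
  ∩-idemʳ Y A = trans (SubsetP.∩-assoc Y A A) (cong (Y ∩_) (SubsetP.∩-idem A))

  A∪[X─A]≡X : (A X : Subset n) → A ⊆ᵇ X ≡ true → A ∪ (X ─ A) ≡ X
  A∪[X─A]≡X []          []          _ = refl
  A∪[X─A]≡X (true ∷ A)  (true ∷ X)  h = cong (true ∷_) (A∪[X─A]≡X A X h)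
  A∪[X─A]≡X (false ∷ A) (x ∷ X)     h = cong (x ∷_) (A∪[X─A]≡X A X h)
  A∪[X─A]≡X (true ∷ A)  (false ∷ X) ()

  ∣A∣+∣X─A∣≡∣X∣ : (A X : Subset n) → A ⊆ᵇ X ≡ true → ∣ A ∣ + ∣ X ─ A ∣ ≡ ∣ X ∣
  ∣A∣+∣X─A∣≡∣X∣ []          []          _ = refl
  ∣A∣+∣X─A∣≡∣X∣ (true ∷ A)  (true ∷ X)  h = cong suc (∣A∣+∣X─A∣≡∣X∣ A X h)
  ∣A∣+∣X─A∣≡∣X∣ (false ∷ A) (true ∷ X)  h = trans (ℕP.+-suc ∣ A ∣ _) (cong suc (∣A∣+∣X─A∣≡∣X∣ A X h))
  ∣A∣+∣X─A∣≡∣X∣ (false ∷ A) (false ∷ X) h = ∣A∣+∣X─A∣≡∣X∣ A X h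
  ∣A∣+∣X─A∣≡∣X∣ (true ∷ A)  (false ∷ X) ()

  ∣Y∩A∣+∣Y∩[X─A]∣≡∣Y∩X∣ : (Y A X : Subset n) → A ⊆ᵇ X ≡ true →
                          ∣ Y ∩ A ∣ + ∣ Y ∩ (X ─ A) ∣ ≡ ∣ Y ∩ X ∣
  ∣Y∩A∣+∣Y∩[X─A]∣≡∣Y∩X∣ []          []          []          _ = refl
  ∣Y∩A∣+∣Y∩[X─A]∣≡∣Y∩X∣ (true ∷ Y)  (true ∷ A)  (true ∷ X)  h =
    cong suc (∣Y∩A∣+∣Y∩[X─A]∣≡∣Y∩X∣ Y A X h)
  ∣Y∩A∣+∣Y∩[X─A]∣≡∣Y∩X∣ (true ∷ Y)  (false ∷ A) (true ∷ X)  h =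
    trans (ℕP.+-suc ∣ Y ∩ A ∣ _) (cong suc (∣Y∩A∣+∣Y∩[X─A]∣≡∣Y∩X∣ Y A X h))
  ∣Y∩A∣+∣Y∩[X─A]∣≡∣Y∩X∣ (false ∷ Y) (true ∷ A)  (true ∷ X)  h = ∣Y∩A∣+∣Y∩[X─A]∣≡∣Y∩X∣ Y A X h
  ∣Y∩A∣+∣Y∩[X─A]∣≡∣Y∩X∣ (false ∷ Y) (false ∷ A) (true ∷ X)  h = ∣Y∩A∣+∣Y∩[X─A]∣≡∣Y∩X∣ Y A X h
  ∣Y∩A∣+∣Y∩[X─A]∣≡∣Y∩X∣ (true ∷ Y)  (false ∷ A) (false ∷ X) h = ∣Y∩A∣+∣Y∩[X─A]∣≡∣Y∩X∣ Y A X h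
  ∣Y∩A∣+∣Y∩[X─A]∣≡∣Y∩X∣ (false ∷ Y) (false ∷ A) (false ∷ X) h = ∣Y∩A∣+∣Y∩[X─A]∣≡∣Y∩X∣ Y A X h
  ∣Y∩A∣+∣Y∩[X─A]∣≡∣Y∩X∣ (y ∷ Y)     (true ∷ A)  (false ∷ X) ()

  ∣[Y∩[X─A]∪A]∩X∣≡∣Y∩[X─A]∣+∣A∣ : (Y A X : Subset n) → A ⊆ᵇ X ≡ true →
                                   ∣ ((Y ∩ (X ─ A)) ∪ A) ∩ X ∣ ≡ ∣ Y ∩ (X ─ A) ∣ + ∣ A ∣
  ∣[Y∩[X─A]∪A]∩X∣≡∣Y∩[X─A]∣+∣A∣ []      []          []          _ = refl
  ∣[Y∩[X─A]∪A]∩X∣≡∣Y∩[X─A]∣+∣A∣ (true ∷ Y)  (true ∷ A)  (true ∷ X)  h =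
    trans (cong suc (∣[Y∩[X─A]∪A]∩X∣≡∣Y∩[X─A]∣+∣A∣ Y A X h)) (sym (ℕP.+-suc _ ∣ A ∣))
  ∣[Y∩[X─A]∪A]∩X∣≡∣Y∩[X─A]∣+∣A∣ (false ∷ Y) (true ∷ A)  (true ∷ X)  h =
    trans (cong suc (∣[Y∩[X─A]∪A]∩X∣≡∣Y∩[X─A]∣+∣A∣ Y A X h)) (sym (ℕP.+-suc _ ∣ A ∣))
  ∣[Y∩[X─A]∪A]∩X∣≡∣Y∩[X─A]∣+∣A∣ (y ∷ Y) (true ∷ A)  (false ∷ X) ()
  ∣[Y∩[X─A]∪A]∩X∣≡∣Y∩[X─A]∣+∣A∣ (true ∷ Y)  (false ∷ A) (true ∷ X) h =
    cong suc (∣[Y∩[X─A]∪A]∩X∣≡∣Y∩[X─A]∣+∣A∣ Y A X h)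
  ∣[Y∩[X─A]∪A]∩X∣≡∣Y∩[X─A]∣+∣A∣ (false ∷ Y) (false ∷ A) (true ∷ X) h =
    ∣[Y∩[X─A]∪A]∩X∣≡∣Y∩[X─A]∣+∣A∣ Y A X h
  ∣[Y∩[X─A]∪A]∩X∣≡∣Y∩[X─A]∣+∣A∣ (true ∷ Y)  (false ∷ A) (false ∷ X) h =
    ∣[Y∩[X─A]∪A]∩X∣≡∣Y∩[X─A]∣+∣A∣ Y A X h
  ∣[Y∩[X─A]∪A]∩X∣≡∣Y∩[X─A]∣+∣A∣ (false ∷ Y) (false ∷ A) (false ∷ X) h =
    ∣[Y∩[X─A]∪A]∩X∣≡∣Y∩[X─A]∣+∣A∣ Y A X h

  ∣I∪L∣≡∣I∣+∣L∣ : (I L : Subset n) → disjointᵇ I L ≡ true → ∣ I ∪ L ∣ ≡ ∣ I ∣ + ∣ L ∣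
  ∣I∪L∣≡∣I∣+∣L∣ []          []          _ = refl
  ∣I∪L∣≡∣I∣+∣L∣ (true ∷ I)  (true ∷ L)  ()
  ∣I∪L∣≡∣I∣+∣L∣ (true ∷ I)  (false ∷ L) h = cong suc (∣I∪L∣≡∣I∣+∣L∣ I L h)
  ∣I∪L∣≡∣I∣+∣L∣ (false ∷ I) (true ∷ L)  h =
    trans (cong suc (∣I∪L∣≡∣I∣+∣L∣ I L h)) (sym (ℕP.+-suc ∣ I ∣ ∣ L ∣))
  ∣I∪L∣≡∣I∣+∣L∣ (false ∷ I) (false ∷ L) h = ∣I∪L∣≡∣I∣+∣L∣ I L h

  I≡[I∪L]─L : (I L : Subset n) → disjointᵇ I L ≡ true → I ≡ (I ∪ L) ─ L
  I≡[I∪L]─L []          []          _ = refl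
  I≡[I∪L]─L (true ∷ I)  (true ∷ L)  ()
  I≡[I∪L]─L (true ∷ I)  (false ∷ L) h = cong (true ∷_) (I≡[I∪L]─L I L h)
  I≡[I∪L]─L (false ∷ I) (true ∷ L)  h = cong (false ∷_) (I≡[I∪L]─L I L h)
  I≡[I∪L]─L (false ∷ I) (false ∷ L) h = cong (false ∷_) (I≡[I∪L]─L I L h)

  [X─I≡ᵇL]≡[I∪L≡ᵇX] : (I L X : Subset n) → I ⊆ᵇ X ≡ true → L ⊆ᵇ X ≡ true →
                      disjointᵇ I L ≡ true → (X ─ I ≡ᵇ L) ≡ (I ∪ L ≡ᵇ X)
  [X─I≡ᵇL]≡[I∪L≡ᵇX] []          []          []          _ _ _ = refl
  [X─I≡ᵇL]≡[I∪L≡ᵇX] (true ∷ I)  (false ∷ L) (true ∷ X)  h₁ h₂ h₃ = [X─I≡ᵇL]≡[I∪L≡ᵇX] I L X h₁ h₂ h₃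
  [X─I≡ᵇL]≡[I∪L≡ᵇX] (false ∷ I) (true ∷ L)  (true ∷ X)  h₁ h₂ h₃ = [X─I≡ᵇL]≡[I∪L≡ᵇX] I L X h₁ h₂ h₃
  [X─I≡ᵇL]≡[I∪L≡ᵇX] (false ∷ I) (false ∷ L) (true ∷ X)  h₁ h₂ h₃ = refl
  [X─I≡ᵇL]≡[I∪L≡ᵇX] (false ∷ I) (false ∷ L) (false ∷ X) h₁ h₂ h₃ = [X─I≡ᵇL]≡[I∪L≡ᵇX] I L X h₁ h₂ h₃
  [X─I≡ᵇL]≡[I∪L≡ᵇX] (true ∷ I)  (true ∷ L)  (x ∷ X)     h₁ h₂ ()
  [X─I≡ᵇL]≡[I∪L≡ᵇX] (true ∷ I)  (false ∷ L) (false ∷ X) () h₂ h₃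
  [X─I≡ᵇL]≡[I∪L≡ᵇX] (false ∷ I) (true ∷ L)  (false ∷ X) h₁ () h₃

  ⊆ᵇ∧∣∣≥⇒≡ : (S X : Subset n) → S ⊆ᵇ X ≡ true → ∣ X ∣ ≤ ∣ S ∣ → S ≡ X
  ⊆ᵇ∧∣∣≥⇒≡ []          []          _ _  = refl
  ⊆ᵇ∧∣∣≥⇒≡ (true ∷ S)  (true ∷ X)  h le = cong (true ∷_) (⊆ᵇ∧∣∣≥⇒≡ S X h (ℕP.≤-pred le))
  ⊆ᵇ∧∣∣≥⇒≡ (true ∷ S)  (false ∷ X) ()
  ⊆ᵇ∧∣∣≥⇒≡ (false ∷ S) (true ∷ X)  h le =
    contradiction (ℕP.<-≤-trans (s≤s (⊆ᵇ⇒∣∣≤ S X h)) le) (ℕP.<-irrefl refl)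
  ⊆ᵇ∧∣∣≥⇒≡ (false ∷ S) (false ∷ X) h le = cong (false ∷_) (⊆ᵇ∧∣∣≥⇒≡ S X h le)

  Disjoint⇒disjointᵇ : (I L : Subset n) → Disjoint I L → disjointᵇ I L ≡ true
  Disjoint⇒disjointᵇ []      []      _ = refl
  Disjoint⇒disjointᵇ (true ∷ I) (true ∷ L) d = ⊥-elim (d zero here here)
  Disjoint⇒disjointᵇ (true ∷ I) (false ∷ L) d = Disjoint⇒disjointᵇ I L (λ i p q → d (suc i) (there p) (there q))
  Disjoint⇒disjointᵇ (false ∷ I) (l ∷ L) d = Disjoint⇒disjointᵇ I L (λ i p q → d (suc i) (there p) (there q))

  Disjoint-A-[X─A] : (A X : Subset n) → Disjoint A (X ─ A)
  Disjoint-A-[X─A] (true ∷ A) (x ∷ X) zero    here      ()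
  Disjoint-A-[X─A] (a ∷ A)    (x ∷ X) (suc i) (there p) (there q) = Disjoint-A-[X─A] A X i p q

  Disjoint-[X─L]-L : (L X : Subset n) → Disjoint (X ─ L) L
  Disjoint-[X─L]-L (true ∷ L) (x ∷ X) zero    ()        here
  Disjoint-[X─L]-L (l ∷ L)    (x ∷ X) (suc i) (there p) (there q) = Disjoint-[X─L]-L L X i p q

  x∉p─p : (p : Subset n) (x : Fin n) → ¬ (x ∈ p ─ p)
  x∉p─p (true ∷ p)  zero    ()
  x∉p─p (false ∷ p) zero    ()
  x∉p─p (_ ∷ p)     (suc x) (there x∈p─p) = x∉p─p p x x∈p─p

  x∈p⇒∣p∣≢0 : (p : Subset n) {x : Fin n} → x ∈ p → ∣ p ∣ ≢ 0
  x∈p⇒∣p∣≢0 p {x} x∈p |p|≡0 =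
    contradiction (subst₂ _≤_ (SubsetP.∣⁅x⁆∣≡1 x) |p|≡0 (SubsetP.p⊆q⇒∣p∣≤∣q∣ x⁅⊆p)) λ ()
    where
    x⁅⊆p : ⁅ x ⁆ ⊆ p
    x⁅⊆p y∈⁅x⁆ = subst (_∈ p) (sym (SubsetP.x∈⁅y⁆⇒x≡y x y∈⁅x⁆)) x∈p

  -- ⁅ x ⁆ for the largest element x of X, and ⊥ for X = ⊥
  ⁅last_⁆ : Subset n → Subset n
  ⁅last [] ⁆ = []
  ⁅last x ∷ p ⁆ with ∣ p ∣
  ... | zero  = x ∷ p
  ... | suc _ = false ∷ ⁅last p ⁆

  ⁅last⁆⊆ᵇ : (X : Subset n) → ⁅last X ⁆ ⊆ᵇ X ≡ true
  ⁅last⁆⊆ᵇ []      = refl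
  ⁅last⁆⊆ᵇ (x ∷ p) with ∣ p ∣
  ... | zero  = ⊆ᵇ-refl (x ∷ p)
  ... | suc _ = ⁅last⁆⊆ᵇ p

  ∣⁅last⁆∣≡1 : (X : Subset n) → 1 ≤ ∣ X ∣ → ∣ ⁅last X ⁆ ∣ ≡ 1
  ∣⁅last⁆∣≡1 (true ∷ p) h with ∣ p ∣ in eq
  ... | zero  = cong suc eq
  ... | suc _ = ∣⁅last⁆∣≡1 p (subst (1 ≤_) (sym eq) (s≤s z≤n))
  ∣⁅last⁆∣≡1 (false ∷ p) h with ∣ p ∣ in eq
  ... | zero  = contradiction h λ ()
  ... | suc _ = ∣⁅last⁆∣≡1 p (subst (1 ≤_) (sym eq) (s≤s z≤n))

  ⁅last⁆-max : (X : Subset n) (i l : Fin n) → i ∈ X ─ ⁅last X ⁆ → l ∈ ⁅last X ⁆ → i <ᶠ l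
  ⁅last⁆-max (x ∷ p) i l i∈ l∈ with ∣ p ∣
  ⁅last⁆-max (x ∷ p) i       l       i∈         l∈         | zero  = ⊥-elim (x∉p─p (x ∷ p) i i∈)
  ⁅last⁆-max (x ∷ p) zero    (suc l) _          (there l∈) | suc _ = s≤s z≤n
  ⁅last⁆-max (x ∷ p) (suc i) (suc l) (there i∈) (there l∈) | suc _ = s≤s (⁅last⁆-max p i l i∈ l∈)

  ∣I∪L∣≡0⇒L≡I∪L : (I L : Subset n) → ∣ I ∪ L ∣ ≡ 0 → L ≡ I ∪ L
  ∣I∪L∣≡0⇒L≡I∪L []          []          _ = refl
  ∣I∪L∣≡0⇒L≡I∪L (false ∷ I) (false ∷ L) h = cong (false ∷_) (∣I∪L∣≡0⇒L≡I∪L I L h)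

  ⁅last⁆-unique : (I L : Subset n) → ∣ L ∣ ≡ 1 → (∀ i l → i ∈ I → l ∈ L → i <ᶠ l) →
                  L ≡ ⁅last I ∪ L ⁆
  ⁅last⁆-unique (a ∷ I) (b ∷ L) |L|≡1 I<L with ∣ I ∪ L ∣ in eq
  ⁅last⁆-unique (a ∷ I) (true ∷ L) |L|≡1 I<L | zero =
    cong₂ _∷_ (sym (BoolP.∨-zeroʳ a)) (∣I∪L∣≡0⇒L≡I∪L I L eq)
  ⁅last⁆-unique (a ∷ I) (false ∷ L) |L|≡1 I<L | zero =
    contradiction (ℕP.≤-trans (ℕP.≤-reflexive (sym |L|≡1))
                    (ℕP.≤-trans (SubsetP.∣q∣≤∣p∪q∣ I L) (ℕP.≤-reflexive eq))) λ ()
  ⁅last⁆-unique {suc n} (a ∷ I) (true ∷ L) |L|≡1 I<L | suc _ with SubsetP.nonempty? (I ∪ L)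
  ... | no  I∪L-empty =
    contradiction (trans (sym eq) (trans (cong ∣_∣ (SubsetP.Empty-unique I∪L-empty)) (SubsetP.∣⊥∣≡0 n))) λ ()
  ... | yes (j , j∈I∪L) with SubsetP.x∈p∪q⁻ I L j∈I∪L
  ...   | inj₁ j∈I = contradiction (I<L (suc j) zero (there j∈I) here) λ ()
  ...   | inj₂ j∈L = ⊥-elim (x∈p⇒∣p∣≢0 L j∈L (ℕP.suc-injective |L|≡1))
  ⁅last⁆-unique (a ∷ I) (false ∷ L) |L|≡1 I<L | suc _ =
    cong (false ∷_) (⁅last⁆-unique I L |L|≡1 λ i l i∈I l∈L →
                       ℕP.≤-pred (I<L (suc i) (suc l) (there i∈I) (there l∈L)))

module _ where
  open import Data.Integer using (_+_; _-_; _*_; -_)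

  infix 9 -1^_
  -1^_ : ℕ → ℤ
  -1^ zero  = + 1
  -1^ suc k = - -1^ k

  infixr 8 [_]*_
  [_]*_ : Bool → ℤ → ℤ
  [ true  ]* z = z
  [ false ]* z = + 0

  sumOver : {A : Set} → List A → (A → ℤ) → ℤ
  sumOver []       f = + 0
  sumOver (x ∷ xs) f = f x + sumOver xs f

  infix 7 sumOver
  syntax sumOver xs (λ x → e) = ∑[ x ∈ xs ] e

  []*-neg : ∀ b z → [ b ]* (- z) ≡ - [ b ]* z
  []*-neg true  z = refl
  []*-neg false z = refl

  []*-* : ∀ b k z → [ b ]* (k * z) ≡ k * [ b ]* z
  []*-* true  k z = refl
  []*-* false k z = sym (ℤP.*-zeroʳ k)

  []*-zero : ∀ b → [ b ]* + 0 ≡ + 0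
  []*-zero true  = refl
  []*-zero false = refl

  []*-∧ : ∀ a b z → [ a ∧ b ]* z ≡ [ a ]* [ b ]* z
  []*-∧ true  b z = refl
  []*-∧ false b z = refl

  []*-comm : ∀ a b z → [ a ]* [ b ]* z ≡ [ b ]* [ a ]* z
  []*-comm true  b     z = refl
  []*-comm false true  z = refl
  []*-comm false false z = refl

  private variable A B : Set

  ∑-cong : (xs : List A) {f g : A → ℤ} → (∀ x → f x ≡ g x) → sumOver xs f ≡ sumOver xs g
  ∑-cong []       h = refl
  ∑-cong (x ∷ xs) h = cong₂ _+_ (h x) (∑-cong xs h)

  ∑-zero : (xs : List A) {f : A → ℤ} → (∀ x → f x ≡ + 0) → sumOver xs f ≡ + 0
  ∑-zero []       h = refl
  ∑-zero (x ∷ xs) h = cong₂ _+_ (h x) (∑-zero xs h)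

  ∑-++ : (xs ys : List A) (f : A → ℤ) → sumOver (xs ++ ys) f ≡ sumOver xs f + sumOver ys f
  ∑-++ []       ys f = sym (ℤP.+-identityˡ _)
  ∑-++ (x ∷ xs) ys f = trans (cong (_+_ (f x)) (∑-++ xs ys f)) (sym (ℤP.+-assoc (f x) _ _))

  ∑-distrib-+ : (xs : List A) (f g : A → ℤ) →
                ∑[ x ∈ xs ] (f x + g x) ≡ sumOver xs f + sumOver xs g
  ∑-distrib-+ []       f g = refl
  ∑-distrib-+ (x ∷ xs) f g rewrite ∑-distrib-+ xs f g = lemma (f x) (g x) (sumOver xs f) (sumOver xs g)
    where
    lemma : ∀ a b c d → a + b + (c + d) ≡ a + c + (b + d)
    lemma = solve-∀

  ∑-neg : (xs : List A) (f : A → ℤ) → ∑[ x ∈ xs ] (- f x) ≡ - sumOver xs f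
  ∑-neg []       f = refl
  ∑-neg (x ∷ xs) f rewrite ∑-neg xs f = sym (ℤP.neg-distrib-+ (f x) _)

  *-distribˡ-∑ : (k : ℤ) (xs : List A) (f : A → ℤ) → ∑[ x ∈ xs ] (k * f x) ≡ k * sumOver xs f
  *-distribˡ-∑ k []       f = sym (ℤP.*-zeroʳ k)
  *-distribˡ-∑ k (x ∷ xs) f rewrite *-distribˡ-∑ k xs f = sym (ℤP.*-distribˡ-+ k (f x) _)

  ∑-filter : ∀ {p} {P : A → Set p} (P? : (x : A) → Dec (P x)) (xs : List A) (f : A → ℤ) →
             sumOver (filter P? xs) f ≡ ∑[ x ∈ xs ] [ does (P? x) ]* f x
  ∑-filter P? []       f = refl
  ∑-filter P? (x ∷ xs) f with does (P? x)
  ... | true  = cong (_+_ (f x)) (∑-filter P? xs f)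
  ... | false = trans (∑-filter P? xs f) (sym (ℤP.+-identityˡ _))

  ∑-map : (h : A → B) (xs : List A) (f : B → ℤ) → sumOver (map h xs) f ≡ ∑[ x ∈ xs ] f (h x)
  ∑-map h []       f = refl
  ∑-map h (x ∷ xs) f = cong (_+_ (f (h x))) (∑-map h xs f)

  ∑-concatMap : (g : A → List B) (xs : List A) (f : B → ℤ) →
                sumOver (concatMap g xs) f ≡ ∑[ x ∈ xs ] sumOver (g x) f
  ∑-concatMap g []       f = refl
  ∑-concatMap g (x ∷ xs) f =
    trans (∑-++ (g x) (concatMap g xs) f) (cong (_+_ (sumOver (g x) f)) (∑-concatMap g xs f))

  ∑-cartesianProduct : (xs : List A) (ys : List B) (f : A × B → ℤ) →
                       sumOver (cartesianProduct xs ys) f ≡ ∑[ x ∈ xs ] ∑[ y ∈ ys ] f (x , y)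
  ∑-cartesianProduct []       ys f = refl
  ∑-cartesianProduct (x ∷ xs) ys f =
    trans (∑-++ (map (x ,_) ys) (cartesianProduct xs ys) f)
          (cong₂ _+_ (∑-map (x ,_) ys f) (∑-cartesianProduct xs ys f))

  -1^-+ : ∀ a b → -1^ (a ℕ.+ b) ≡ -1^ a * -1^ b
  -1^-+ zero    b = sym (ℤP.*-identityˡ (-1^ b))
  -1^-+ (suc a) b rewrite -1^-+ a b = ℤP.neg-distribˡ-* (-1^ a) (-1^ b)

  -1^-square : ∀ a → -1^ a * -1^ a ≡ + 1
  -1^-square zero    = refl
  -1^-square (suc a) = trans (lemma (-1^ a)) (-1^-square a)
    where
    lemma : ∀ z → - z * - z ≡ z * z
    lemma = solve-∀

  -1^[a∸b+1] : ∀ a b → b ≤ a → -1^ (a ℕ.∸ b ℕ.+ 1) ≡ - (-1^ b * -1^ a)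
  -1^[a∸b+1] a b b≤a = begin
    -1^ (a ℕ.∸ b ℕ.+ 1)                 ≡⟨ -1^-+ (a ℕ.∸ b) 1 ⟩
    -1^ (a ℕ.∸ b) * - + 1               ≡⟨ lemma₁ (-1^ (a ℕ.∸ b)) ⟩
    - (-1^ (a ℕ.∸ b) * + 1)             ≡⟨ cong (λ w → - (-1^ (a ℕ.∸ b) * w)) (sym (-1^-square b)) ⟩
    - (-1^ (a ℕ.∸ b) * (-1^ b * -1^ b)) ≡⟨ cong -_ (lemma₂ (-1^ (a ℕ.∸ b)) (-1^ b)) ⟩
    - (-1^ b * (-1^ (a ℕ.∸ b) * -1^ b)) ≡⟨ cong (λ w → - (-1^ b * w)) (sym (-1^-+ (a ℕ.∸ b) b)) ⟩
    - (-1^ b * -1^ (a ℕ.∸ b ℕ.+ b))     ≡⟨ cong (λ w → - (-1^ b * -1^ w)) (ℕP.m∸n+n≡m b≤a) ⟩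
    - (-1^ b * -1^ a)                   ∎
    where
    open ≡-Reasoning
    lemma₁ : ∀ z → z * - + 1 ≡ - (z * + 1)
    lemma₁ = solve-∀
    lemma₂ : ∀ x y → x * (y * y) ≡ y * (x * y)
    lemma₂ = solve-∀

  ∑-allSubsets-suc : ∀ n (f : Subset (suc n) → ℤ) →
    ∑[ A ∈ allSubsets (suc n) ] f A ≡ ∑[ A ∈ allSubsets n ] f (false ∷ A) + ∑[ A ∈ allSubsets n ] f (true ∷ A)
  ∑-allSubsets-suc n f =
    trans (∑-++ (map (false ∷_) (allSubsets n)) (map (true ∷_) (allSubsets n)) f)
          (cong₂ _+_ (∑-map (false ∷_) (allSubsets n) f) (∑-map (true ∷_) (allSubsets n) f))

  ∑-δ : (X : Subset n) (h : Subset n → ℤ) → ∑[ A ∈ allSubsets n ] [ A ≡ᵇ X ]* h A ≡ h X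
  ∑-δ []          h = ℤP.+-identityʳ (h [])
  ∑-δ {suc n} (false ∷ X) h = begin
    _ ≡⟨ ∑-allSubsets-suc n _ ⟩
    _ ≡⟨ cong₂ _+_ (∑-δ X (λ A → h (false ∷ A))) (∑-zero (allSubsets n) λ _ → refl) ⟩
    _ ≡⟨ ℤP.+-identityʳ _ ⟩
    _ ∎
    where open ≡-Reasoning
  ∑-δ {suc n} (true ∷ X) h = begin
    _ ≡⟨ ∑-allSubsets-suc n _ ⟩
    _ ≡⟨ cong₂ _+_ (∑-zero (allSubsets n) λ _ → refl) (∑-δ X (λ A → h (true ∷ A))) ⟩
    _ ≡⟨ ℤP.+-identityˡ _ ⟩
    _ ∎
    where open ≡-Reasoning

  ∑-alternating : (S X : Subset n) →
    ∑[ A ∈ allSubsets n ] [ (S ⊆ᵇ A) ∧ (A ⊆ᵇ X) ]* -1^ ∣ A ∣ ≡ [ S ≡ᵇ X ]* -1^ ∣ X ∣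
  ∑-alternating []          []          = refl
  ∑-alternating {suc n} (false ∷ S) (false ∷ X) = begin
    _ ≡⟨ ∑-allSubsets-suc n _ ⟩
    _ ≡⟨ cong₂ _+_ (∑-alternating S X)
                   (∑-zero (allSubsets n) λ A → cong (λ b → [ b ]* _) (BoolP.∧-zeroʳ (S ⊆ᵇ A))) ⟩
    _ ≡⟨ ℤP.+-identityʳ _ ⟩
    _ ∎
    where open ≡-Reasoning
  ∑-alternating {suc n} (false ∷ S) (true ∷ X) = begin
    _       ≡⟨ ∑-allSubsets-suc n _ ⟩
    _       ≡⟨ cong (_+_ t) (trans (∑-cong (allSubsets n) λ A → []*-neg ((S ⊆ᵇ A) ∧ (A ⊆ᵇ X)) (-1^ ∣ A ∣))
                                   (∑-neg (allSubsets n) _)) ⟩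
    t - t   ≡⟨ ℤP.+-inverseʳ t ⟩
    + 0     ∎
    where
    open ≡-Reasoning
    t : ℤ
    t = ∑[ A ∈ allSubsets n ] [ (S ⊆ᵇ A) ∧ (A ⊆ᵇ X) ]* -1^ ∣ A ∣
  ∑-alternating {suc n} (true ∷ S) (false ∷ X) =
    trans (∑-allSubsets-suc n _)
          (cong₂ _+_ (∑-zero (allSubsets n) λ _ → refl)
                     (∑-zero (allSubsets n) λ A → cong (λ b → [ b ]* _) (BoolP.∧-zeroʳ (S ⊆ᵇ A))))
  ∑-alternating {suc n} (true ∷ S) (true ∷ X) = begin
    _ ≡⟨ ∑-allSubsets-suc n _ ⟩
    _ ≡⟨ cong₂ _+_ (∑-zero (allSubsets n) λ _ → refl)
                   (trans (∑-cong (allSubsets n) λ A → []*-neg ((S ⊆ᵇ A) ∧ (A ⊆ᵇ X)) (-1^ ∣ A ∣))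
                          (∑-neg (allSubsets n) _)) ⟩
    _ ≡⟨ ℤP.+-identityˡ _ ⟩
    _ ≡⟨ cong -_ (∑-alternating S X) ⟩
    _ ≡⟨ sym ([]*-neg (S ≡ᵇ X) (-1^ ∣ X ∣)) ⟩
    _ ∎
    where open ≡-Reasoning

  [⊂ᵇ]≡[⊆ᵇ]-[≡ᵇ] : (A X : Subset n) (z : ℤ) → [ A ⊂ᵇ X ]* z ≡ [ A ⊆ᵇ X ]* z - [ A ≡ᵇ X ]* z
  [⊂ᵇ]≡[⊆ᵇ]-[≡ᵇ] []          []          z = sym (ℤP.+-inverseʳ z)
  [⊂ᵇ]≡[⊆ᵇ]-[≡ᵇ] (false ∷ A) (false ∷ X) z = [⊂ᵇ]≡[⊆ᵇ]-[≡ᵇ] A X z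
  [⊂ᵇ]≡[⊆ᵇ]-[≡ᵇ] (false ∷ A) (true ∷ X)  z = sym (ℤP.+-identityʳ _)
  [⊂ᵇ]≡[⊆ᵇ]-[≡ᵇ] (true ∷ A)  (false ∷ X) z = refl
  [⊂ᵇ]≡[⊆ᵇ]-[≡ᵇ] (true ∷ A)  (true ∷ X)  z = [⊂ᵇ]≡[⊆ᵇ]-[≡ᵇ] A X z

  ∑-proper-subsets : (X : Subset n) → 1 ≤ ∣ X ∣ →
                     ∑[ A ∈ allSubsets n ] [ A ⊂ᵇ X ]* -1^ ∣ A ∣ ≡ - -1^ ∣ X ∣
  ∑-proper-subsets {n} X 1≤|X| = begin
    ∑[ A ∈ allSubsets n ] [ A ⊂ᵇ X ]* -1^ ∣ A ∣
      ≡⟨ ∑-cong (allSubsets n) (λ A → [⊂ᵇ]≡[⊆ᵇ]-[≡ᵇ] A X (-1^ ∣ A ∣)) ⟩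
    ∑[ A ∈ allSubsets n ] ([ A ⊆ᵇ X ]* -1^ ∣ A ∣ - [ A ≡ᵇ X ]* -1^ ∣ A ∣)
      ≡⟨ ∑-distrib-+ (allSubsets n) _ _ ⟩
    ∑[ A ∈ allSubsets n ] [ A ⊆ᵇ X ]* -1^ ∣ A ∣ + ∑[ A ∈ allSubsets n ] (- [ A ≡ᵇ X ]* -1^ ∣ A ∣)
      ≡⟨ cong₂ _+_ ∑-subsets
                   (trans (∑-neg (allSubsets n) _) (cong (λ z → - z) (∑-δ X (λ A → -1^ ∣ A ∣)))) ⟩
    + 0 + - -1^ ∣ X ∣
      ≡⟨ ℤP.+-identityˡ _ ⟩
    - -1^ ∣ X ∣
      ∎
    where
    open ≡-Reasoning
    ∑-subsets : ∑[ A ∈ allSubsets n ] [ A ⊆ᵇ X ]* -1^ ∣ A ∣ ≡ + 0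
    ∑-subsets = begin
      ∑[ A ∈ allSubsets n ] [ A ⊆ᵇ X ]* -1^ ∣ A ∣
        ≡⟨ ∑-cong (allSubsets n) (λ A → cong (λ b → [ b ∧ (A ⊆ᵇ X) ]* -1^ ∣ A ∣) (⊥-⊆ᵇ A)) ⟨
      ∑[ A ∈ allSubsets n ] [ (⊥ ⊆ᵇ A) ∧ (A ⊆ᵇ X) ]* -1^ ∣ A ∣
        ≡⟨ ∑-alternating ⊥ X ⟩
      [ ⊥ ≡ᵇ X ]* -1^ ∣ X ∣
        ≡⟨ cong (λ b → [ b ]* -1^ ∣ X ∣) (⊥≡ᵇX X 1≤|X|) ⟩
      + 0
        ∎


module Coefficients {Λ : Set} (_≟_ : DecidableEquality Λ) where
  open import Data.Integer using (_+_; -_)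

  coeff : List (ℤ × Λ) → Λ → ℤ
  coeff xs l = ∑[ e ∈ xs ] [ does (proj₂ e ≟ l) ]* proj₁ e

  remove : Λ → List (ℤ × Λ) → List (ℤ × Λ)
  remove l = filter λ e → ¬? (proj₂ e ≟ l)

  coeff-remove-self : ∀ l xs → coeff (remove l xs) l ≡ + 0
  coeff-remove-self l []             = refl
  coeff-remove-self l ((z , μ) ∷ xs) with μ ≟ l in eq
  ... | yes _ = coeff-remove-self l xs
  ... | no  _ rewrite eq = trans (ℤP.+-identityˡ _) (coeff-remove-self l xs)

  coeff-remove-other : ∀ μ l xs → μ ≢ l → coeff (remove μ xs) l ≡ coeff xs l
  coeff-remove-other μ l []             μ≢l = refl
  coeff-remove-other μ l ((z , ν) ∷ xs) μ≢l with ν ≟ μ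
  ... | yes refl rewrite dec-false (ν ≟ l) μ≢l =
    trans (coeff-remove-other ν l xs μ≢l) (sym (ℤP.+-identityˡ _))
  ... | no  _    = cong (_+_ ([ does (ν ≟ l) ]* z)) (coeff-remove-other μ l xs μ≢l)

  length-remove-∷ : ∀ z l xs → length (remove l ((z , l) ∷ xs)) ≤ length xs
  length-remove-∷ z l xs with l ≟ l
  ... | yes _   = ListP.length-filter (λ e → ¬? (proj₂ e ≟ l)) xs
  ... | no l≢l = contradiction refl l≢l

  negate : List (ℤ × Λ) → List (ℤ × Λ)
  negate = map λ e → - proj₁ e , proj₂ e

  coeff-negate : ∀ xs l → coeff (negate xs) l ≡ - coeff xs l
  coeff-negate xs l =
    trans (∑-map _ xs _) (trans (∑-cong xs λ e → []*-neg (does (proj₂ e ≟ l)) (proj₁ e)) (∑-neg xs _))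

  coeff-concatMap : {A : Set} (g : A → List (ℤ × Λ)) (xs : List A) (l : Λ) →
                    coeff (concatMap g xs) l ≡ ∑[ a ∈ xs ] coeff (g a) l
  coeff-concatMap g xs l = ∑-concatMap g xs _

module _ where
  open import Data.Nat using (_+_; _∸_)

  infix 4 _≈ᴹ_
  _≈ᴹ_ : Matroid n → Matroid n → Set
  M ≈ᴹ N = ground M ≡ ground N × (∀ Y → rank M Y ≡ rank N Y)

  ≈ᴹ-refl : {M : Matroid n} → M ≈ᴹ M
  ≈ᴹ-refl = refl , λ _ → refl

  ≈ᴹ⇒≅ : {M N : Matroid n} → M ≈ᴹ N → M ≅ N
  ≈ᴹ⇒≅ {M = M} {N} (g , r) =
    Perm.id , trans (tabulate∘lookup (ground M)) g ,
    λ Y _ → trans (cong (rank N) (tabulate∘lookup Y)) (sym (r Y))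

  ⊕-cong : {M M′ N N′ : Matroid n} → M ≈ᴹ M′ → N ≈ᴹ N′ → (M ⊕ N) ≈ᴹ (M′ ⊕ N′)
  ⊕-cong {M = mat G r} {mat .G r′} {mat H s} {mat .H s′} (refl , r≗r′) (refl , s≗s′) =
    refl , λ Y → cong₂ _+_ (r≗r′ _) (s≗s′ _)

  ∣ʳ-cong : {M M′ : Matroid n} (A : Subset n) → M ≈ᴹ M′ → (M ∣ʳ A) ≈ᴹ (M′ ∣ʳ A)
  ∣ʳ-cong A (_ , r≗r′) = refl , λ _ → r≗r′ _

  /-cong : {M M′ : Matroid n} (A : Subset n) → M ≈ᴹ M′ → (M / A) ≈ᴹ (M′ / A)
  /-cong {M = mat G r} {mat .G r′} A (refl , r≗r′) = refl , λ _ → cong₂ _∸_ (r≗r′ _) (r≗r′ _)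

module Combinations {c ℓ₁ ℓ₂} (K : HeytingField c ℓ₁ ℓ₂) (n : ℕ) where
  open Over K n
  open CommutativeRing (HeytingCommutativeRing.commutativeRing (HeytingField.heytingCommutativeRing K))
    using (Carrier; _≈_; _+_; -_; 0#; 1#; +-cong; -‿cong; +-assoc; +-comm;
           +-identityˡ; +-identityʳ; -‿inverseʳ; +-abelianGroup; +-monoid)
    renaming (setoid to ≈-setoid; refl to ≈-refl; sym to ≈-sym; trans to ≈-trans; reflexive to ≈-reflexive)
  open import Algebra.Properties.AbelianGroup +-abelianGroup using (⁻¹-∙-comm; ⁻¹-involutive; ε⁻¹≈ε)

  -- ≋ with ≈ᴹ in place of ≅; unlike ≅, ≈ᴹ is a congruence for ⊕, restriction
  -- and contraction, which the recursion for the antipode needs.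
  infix 4 _≈ᶜ_
  data _≈ᶜ_ : Comb → Comb → Set (c ⊔ ℓ₁) where
    ≈ᶜ-refl  : ∀ {x} → x ≈ᶜ x
    ≈ᶜ-sym   : ∀ {x y} → x ≈ᶜ y → y ≈ᶜ x
    ≈ᶜ-trans : ∀ {x y z} → x ≈ᶜ y → y ≈ᶜ z → x ≈ᶜ z
    ≈ᶜ-cons  : ∀ t {x y} → x ≈ᶜ y → (t ∷ x) ≈ᶜ (t ∷ y)
    ≈ᶜ-swap  : ∀ s t x → (s ∷ t ∷ x) ≈ᶜ (t ∷ s ∷ x)
    ≈ᶜ-term  : ∀ {a b M N} x → a ≈ b → M ≈ᴹ N → ((a , M) ∷ x) ≈ᶜ ((b , N) ∷ x)
    ≈ᶜ-merge : ∀ a b M x → ((a , M) ∷ (b , M) ∷ x) ≈ᶜ ((a + b , M) ∷ x)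
    ≈ᶜ-zero  : ∀ M x → ((0# , M) ∷ x) ≈ᶜ x

  ≈ᶜ⇒≋ : ∀ {x y} → x ≈ᶜ y → x ≋ y
  ≈ᶜ⇒≋ ≈ᶜ-refl            = ≋-refl
  ≈ᶜ⇒≋ (≈ᶜ-sym p)         = ≋-sym (≈ᶜ⇒≋ p)
  ≈ᶜ⇒≋ (≈ᶜ-trans p q)     = ≋-trans (≈ᶜ⇒≋ p) (≈ᶜ⇒≋ q)
  ≈ᶜ⇒≋ (≈ᶜ-cons t p)      = ≋-cons t (≈ᶜ⇒≋ p)
  ≈ᶜ⇒≋ (≈ᶜ-swap s t x)    = ≋-swap s t x
  ≈ᶜ⇒≋ (≈ᶜ-term x a≈b M≈N) = ≋-term x a≈b (≈ᴹ⇒≅ M≈N)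
  ≈ᶜ⇒≋ (≈ᶜ-merge a b M x) = ≋-merge a b M x
  ≈ᶜ⇒≋ (≈ᶜ-zero M x)      = ≋-zero M x

  ≈ᶜ-setoid : Setoid c (c ⊔ ℓ₁)
  ≈ᶜ-setoid = record
    { Carrier       = Comb
    ; _≈_           = _≈ᶜ_
    ; isEquivalence = record { refl = ≈ᶜ-refl ; sym = ≈ᶜ-sym ; trans = ≈ᶜ-trans }
    }

  module ≈-Reasoning = Relation.Binary.Reasoning.Setoid ≈-setoid
  module ≈ᶜ-Reasoning = Relation.Binary.Reasoning.Setoid ≈ᶜ-setoid

  ++⁺ˡ : ∀ {x y} z → x ≈ᶜ y → (x ++ z) ≈ᶜ (y ++ z)
  ++⁺ˡ z ≈ᶜ-refl             = ≈ᶜ-refl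
  ++⁺ˡ z (≈ᶜ-sym p)          = ≈ᶜ-sym (++⁺ˡ z p)
  ++⁺ˡ z (≈ᶜ-trans p q)      = ≈ᶜ-trans (++⁺ˡ z p) (++⁺ˡ z q)
  ++⁺ˡ z (≈ᶜ-cons t p)       = ≈ᶜ-cons t (++⁺ˡ z p)
  ++⁺ˡ z (≈ᶜ-swap s t x)     = ≈ᶜ-swap s t (x ++ z)
  ++⁺ˡ z (≈ᶜ-term x a≈b M≈N) = ≈ᶜ-term (x ++ z) a≈b M≈N
  ++⁺ˡ z (≈ᶜ-merge a b M x)  = ≈ᶜ-merge a b M (x ++ z)
  ++⁺ˡ z (≈ᶜ-zero M x)       = ≈ᶜ-zero M (x ++ z)

  ++⁺ʳ : ∀ x {y z} → y ≈ᶜ z → (x ++ y) ≈ᶜ (x ++ z)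
  ++⁺ʳ []      p = p
  ++⁺ʳ (t ∷ x) p = ≈ᶜ-cons t (++⁺ʳ x p)

  ++⁺ : ∀ {x y u v} → x ≈ᶜ y → u ≈ᶜ v → (x ++ u) ≈ᶜ (y ++ v)
  ++⁺ {y = y} {u} p q = ≈ᶜ-trans (++⁺ˡ u p) (++⁺ʳ y q)

  concatMap⁺ : ∀ {A : Set} {F G : A → Comb} (xs : List A) →
               (∀ a → F a ≈ᶜ G a) → concatMap F xs ≈ᶜ concatMap G xs
  concatMap⁺ []       F≈G = ≈ᶜ-refl
  concatMap⁺ (a ∷ xs) F≈G = ++⁺ (F≈G a) (concatMap⁺ xs F≈G)

  concatMap-filter⁺ : ∀ {A : Set} {p} {P : A → Set p} (P? : ∀ a → Dec (P a)) {F G : A → Comb}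
                      (xs : List A) → (∀ a → P a → F a ≈ᶜ G a) →
                      concatMap F (filter P? xs) ≈ᶜ concatMap G (filter P? xs)
  concatMap-filter⁺ P? []       F≈G = ≈ᶜ-refl
  concatMap-filter⁺ P? (a ∷ xs) F≈G with P? a
  ... | yes Pa = ++⁺ (F≈G a Pa) (concatMap-filter⁺ P? xs F≈G)
  ... | no  _  = concatMap-filter⁺ P? xs F≈G

  module _ (f : Carrier → Carrier) (g : Matroid n → Matroid n)
           (f-cong : ∀ {a b} → a ≈ b → f a ≈ f b) (f-+ : ∀ a b → f (a + b) ≈ f a + f b)
           (f-0 : f 0# ≈ 0#) (g-cong : ∀ {M N} → M ≈ᴹ N → g M ≈ᴹ g N) where

    map⁺ : ∀ {x y} → x ≈ᶜ y →
           map (λ t → f (proj₁ t) , g (proj₂ t)) x ≈ᶜ map (λ t → f (proj₁ t) , g (proj₂ t)) y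
    map⁺ ≈ᶜ-refl             = ≈ᶜ-refl
    map⁺ (≈ᶜ-sym p)          = ≈ᶜ-sym (map⁺ p)
    map⁺ (≈ᶜ-trans p q)      = ≈ᶜ-trans (map⁺ p) (map⁺ q)
    map⁺ (≈ᶜ-cons t p)       = ≈ᶜ-cons _ (map⁺ p)
    map⁺ (≈ᶜ-swap s t x)     = ≈ᶜ-swap _ _ _
    map⁺ (≈ᶜ-term x a≈b M≈N) = ≈ᶜ-term _ (f-cong a≈b) (g-cong M≈N)
    map⁺ (≈ᶜ-merge a b M x)  = ≈ᶜ-trans (≈ᶜ-merge (f a) (f b) (g M) _) (≈ᶜ-term _ (≈-sym (f-+ a b)) ≈ᴹ-refl)
    map⁺ (≈ᶜ-zero M x)       = ≈ᶜ-trans (≈ᶜ-term _ f-0 ≈ᴹ-refl) (≈ᶜ-zero (g M) _)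

  -‿+ : ∀ a b → - (a + b) ≈ - a + - b
  -‿+ a b = ≈-sym (⁻¹-∙-comm a b)

  negC⁺ : ∀ {x y} → x ≈ᶜ y → negC x ≈ᶜ negC y
  negC⁺ = map⁺ -_ (λ M → M) -‿cong -‿+ ε⁻¹≈ε (λ p → p)

  ⊕ᶜ⁺ˡ : ∀ {x y} N → x ≈ᶜ y → (x ⊕ᶜ N) ≈ᶜ (y ⊕ᶜ N)
  ⊕ᶜ⁺ˡ N = map⁺ (λ a → a) (_⊕ N) (λ p → p) (λ _ _ → ≈-refl) ≈-refl (λ p → ⊕-cong {N = N} p ≈ᴹ-refl)

  infix 4 _≈ᵖ_
  _≈ᵖ_ : Comb → Comb → Set (c ⊔ ℓ₁)
  _≈ᵖ_ = Pointwise λ s t → proj₁ s ≈ proj₁ t × proj₂ s ≈ᴹ proj₂ t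

  ≈ᵖ⇒≈ᶜ : ∀ {x y} → x ≈ᵖ y → x ≈ᶜ y
  ≈ᵖ⇒≈ᶜ []                       = ≈ᶜ-refl
  ≈ᵖ⇒≈ᶜ ((a≈b , M≈N) ∷ x≈ᵖy) = ≈ᶜ-trans (≈ᶜ-term _ a≈b M≈N) (≈ᶜ-cons _ (≈ᵖ⇒≈ᶜ x≈ᵖy))

  ⊕ᶜ⁺ʳ : ∀ x {N N′} → N ≈ᴹ N′ → (x ⊕ᶜ N) ≈ᵖ (x ⊕ᶜ N′)
  ⊕ᶜ⁺ʳ []      N≈N′ = []
  ⊕ᶜ⁺ʳ (t ∷ x) N≈N′ = (≈-refl , ⊕-cong {M = proj₂ t} ≈ᴹ-refl N≈N′) ∷ ⊕ᶜ⁺ʳ x N≈N′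

  ⊕ᶜ⁺ : ∀ {x y N N′} → x ≈ᶜ y → N ≈ᴹ N′ → (x ⊕ᶜ N) ≈ᶜ (y ⊕ᶜ N′)
  ⊕ᶜ⁺ {y = y} {N} x≈y N≈N′ = ≈ᶜ-trans (⊕ᶜ⁺ˡ N x≈y) (≈ᵖ⇒≈ᶜ (⊕ᶜ⁺ʳ y N≈N′))

  antipodeF-cong : ∀ f {M M′} → M ≈ᴹ M′ → antipodeF f M ≈ᶜ antipodeF f M′
  antipodeF-cong zero    M≈M′ = ≈ᶜ-refl
  antipodeF-cong (suc f) {mat G r} {mat .G r′} M≈M′@(refl , _) with ∣ G ∣ ℕ.≟ 0
  ... | yes _ = ≈ᶜ-term [] ≈-refl M≈M′
  ... | no  _ = negC⁺ (concatMap⁺ (properSubsets G) λ A →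
                  ⊕ᶜ⁺ (antipodeF-cong f (∣ʳ-cong A M≈M′)) (/-cong A M≈M′))

  open import Algebra.Properties.Monoid.Mult +-monoid using (×-homo-+) renaming (_×_ to _×′_)

  ⟦_⟧ : ℤ → Carrier
  ⟦ + k      ⟧ = k ×′ 1#
  ⟦ -[1+ k ] ⟧ = - (suc k ×′ 1#)

  ⟦⊖⟧ : ∀ m k → ⟦ m ℤ.⊖ k ⟧ ≈ m ×′ 1# + - (k ×′ 1#)
  ⟦⊖⟧ m       zero    = ≈-trans (≈-reflexive (cong ⟦_⟧ (ℤP.⊖-≥ {m} z≤n)))
                                (≈-sym (≈-trans (+-cong ≈-refl ε⁻¹≈ε) (+-identityʳ _)))
  ⟦⊖⟧ zero    (suc k) = ≈-sym (+-identityˡ _)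
  ⟦⊖⟧ (suc m) (suc k) = ≈-trans (≈-reflexive (cong ⟦_⟧ (ℤP.[1+m]⊖[1+n]≡m⊖n m k)))
                                (≈-trans (⟦⊖⟧ m k) (≈-sym (x+a-[x+b]≈a-b 1# (m ×′ 1#) (k ×′ 1#))))
    where
    x+a-[x+b]≈a-b : ∀ x a b → (x + a) + - (x + b) ≈ a + - b
    x+a-[x+b]≈a-b x a b = begin
      (x + a) + - (x + b)   ≈⟨ +-cong (+-comm x a) (-‿+ x b) ⟩
      (a + x) + (- x + - b) ≈⟨ +-assoc a x _ ⟩
      a + (x + (- x + - b)) ≈⟨ +-cong ≈-refl (+-assoc x (- x) (- b)) ⟨
      a + ((x + - x) + - b) ≈⟨ +-cong ≈-refl (+-cong (-‿inverseʳ x) ≈-refl) ⟩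
      a + (0# + - b)        ≈⟨ +-cong ≈-refl (+-identityˡ _) ⟩
      a + - b               ∎
      where open ≈-Reasoning

  ⟦+⟧ : ∀ i j → ⟦ i ℤ.+ j ⟧ ≈ ⟦ i ⟧ + ⟦ j ⟧
  ⟦+⟧ (+ m)      (+ k)      = ×-homo-+ 1# m k
  ⟦+⟧ (+ m)      -[1+ k ]   = ⟦⊖⟧ m (suc k)
  ⟦+⟧ -[1+ m ]   (+ k)      = ≈-trans (⟦⊖⟧ k (suc m)) (+-comm _ _)
  ⟦+⟧ -[1+ m ]   -[1+ k ]   = begin
    - (suc (suc (m ℕ.+ k)) ×′ 1#)              ≡⟨ cong (λ j → - (suc j ×′ 1#)) (sym (ℕP.+-suc m k)) ⟩
    - ((suc m ℕ.+ suc k) ×′ 1#)                ≈⟨ -‿cong (×-homo-+ 1# (suc m) (suc k)) ⟩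
    - (suc m ×′ 1# + suc k ×′ 1#)              ≈⟨ -‿+ _ _ ⟩
    - (suc m ×′ 1#) + - (suc k ×′ 1#)          ∎
    where open ≈-Reasoning

  ⟦-⟧ : ∀ i → ⟦ ℤ.- i ⟧ ≈ - ⟦ i ⟧
  ⟦-⟧ (+ zero)  = ≈-sym ε⁻¹≈ε
  ⟦-⟧ (+ suc k) = ≈-refl
  ⟦-⟧ -[1+ k ]  = ≈-sym (⁻¹-involutive _)

  ⟦-1^⟧ : ∀ k → ⟦ -1^ k ⟧ ≈ sgn k
  ⟦-1^⟧ zero    = +-identityʳ 1#
  ⟦-1^⟧ (suc k) = ≈-trans (⟦-⟧ (-1^ k)) (-‿cong (⟦-1^⟧ k))

  -- Combinations are computed as integer coefficients on labels and only then
  -- turned into matroid combinations through term.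
  module Labelled {Λ : Set} (_≟_ : DecidableEquality Λ) (term : Λ → Matroid n) where
    open Coefficients _≟_

    realize : List (ℤ × Λ) → Comb
    realize = map λ e → ⟦ proj₁ e ⟧ , term (proj₂ e)

    negC-realize : ∀ xs → negC (realize xs) ≈ᵖ realize (negate xs)
    negC-realize []            = []
    negC-realize ((z , _) ∷ xs) = (≈-sym (⟦-⟧ z) , ≈ᴹ-refl) ∷ negC-realize xs

    concatMap-realize : {A : Set} (g : A → List (ℤ × Λ)) (xs : List A) →
                        concatMap (realize ∘ g) xs ≡ realize (concatMap g xs)
    concatMap-realize g xs = sym (ListP.map-concatMap _ g xs)

    extract : ∀ l xs → realize xs ≈ᶜ (⟦ coeff xs l ⟧ , term l) ∷ realize (remove l xs)
    extract l []             = ≈ᶜ-sym (≈ᶜ-zero (term l) [])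
    extract l ((z , μ) ∷ xs) with μ ≟ l
    ... | yes refl = begin
      (⟦ z ⟧ , term l) ∷ realize xs
        ≈⟨ ≈ᶜ-cons _ (extract l xs) ⟩
      (⟦ z ⟧ , term l) ∷ (⟦ coeff xs l ⟧ , term l) ∷ realize (remove l xs)
        ≈⟨ ≈ᶜ-merge _ _ _ _ ⟩
      (⟦ z ⟧ + ⟦ coeff xs l ⟧ , term l) ∷ realize (remove l xs)
        ≈⟨ ≈ᶜ-term _ (≈-sym (⟦+⟧ z _)) ≈ᴹ-refl ⟩
      (⟦ z ℤ.+ coeff xs l ⟧ , term l) ∷ realize (remove l xs)
        ∎
      where open ≈ᶜ-Reasoning
    ... | no  _    = begin
      (⟦ z ⟧ , term μ) ∷ realize xs
        ≈⟨ ≈ᶜ-cons _ (extract l xs) ⟩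
      (⟦ z ⟧ , term μ) ∷ (⟦ coeff xs l ⟧ , term l) ∷ realize (remove l xs)
        ≈⟨ ≈ᶜ-swap _ _ _ ⟩
      (⟦ coeff xs l ⟧ , term l) ∷ (⟦ z ⟧ , term μ) ∷ realize (remove l xs)
        ≈⟨ ≈ᶜ-term _ (≈-reflexive (cong ⟦_⟧ (sym (ℤP.+-identityˡ (coeff xs l))))) ≈ᴹ-refl ⟩
      (⟦ + 0 ℤ.+ coeff xs l ⟧ , term l) ∷ (⟦ z ⟧ , term μ) ∷ realize (remove l xs)
        ∎
      where open ≈ᶜ-Reasoning

    private
      coeff≗⇒≈ᶜ-fuel : ∀ k xs ys → length xs ℕ.+ length ys ≤ k →
                       (∀ l → coeff xs l ≡ coeff ys l) → realize xs ≈ᶜ realize ys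
      pivot : ∀ k μ xs ys → length (remove μ xs) ℕ.+ length (remove μ ys) ≤ k →
              (∀ l → coeff xs l ≡ coeff ys l) → realize xs ≈ᶜ realize ys

      coeff≗⇒≈ᶜ-fuel _       []                  []                  _   _ = ≈ᶜ-refl
      coeff≗⇒≈ᶜ-fuel (suc k) xs@((_ , μ) ∷ xs′) ys                  len h = pivot k μ xs ys
        (ℕP.≤-trans (ℕP.+-mono-≤ (length-remove-∷ _ μ xs′) (ListP.length-filter _ ys)) (ℕP.≤-pred len)) h
      coeff≗⇒≈ᶜ-fuel (suc k) []                  ys@((_ , μ) ∷ ys′) len h = pivot k μ [] ys
        (ℕP.≤-trans (length-remove-∷ _ μ ys′) (ℕP.≤-pred len)) h

      pivot k μ xs ys len h = begin
        realize xs
          ≈⟨ extract μ xs ⟩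
        (⟦ coeff xs μ ⟧ , term μ) ∷ realize (remove μ xs)
          ≈⟨ ≈ᶜ-term _ (≈-reflexive (cong ⟦_⟧ (h μ))) ≈ᴹ-refl ⟩
        (⟦ coeff ys μ ⟧ , term μ) ∷ realize (remove μ xs)
          ≈⟨ ≈ᶜ-cons _ (coeff≗⇒≈ᶜ-fuel k _ _ len h′) ⟩
        (⟦ coeff ys μ ⟧ , term μ) ∷ realize (remove μ ys)
          ≈⟨ extract μ ys ⟨
        realize ys
          ∎
        where
        open ≈ᶜ-Reasoning
        h′ : ∀ l → coeff (remove μ xs) l ≡ coeff (remove μ ys) l
        h′ l with μ ≟ l
        ... | yes refl = trans (coeff-remove-self μ xs) (sym (coeff-remove-self μ ys))
        ... | no  μ≢l  = trans (coeff-remove-other μ l xs μ≢l) (trans (h l) (sym (coeff-remove-other μ l ys μ≢l)))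

    coeff≗⇒≈ᶜ : ∀ xs ys → (∀ l → coeff xs l ≡ coeff ys l) → realize xs ≈ᶜ realize ys
    coeff≗⇒≈ᶜ xs ys = coeff≗⇒≈ᶜ-fuel _ xs ys ℕP.≤-refl

-- Rank identities for direct sums of uniform matroids

module _ where
  open import Data.Nat using (_+_; _∸_; _⊓_)

  m⊓[k+a]∸m⊓a≡[m∸a]⊓k : ∀ m k a → m ⊓ (k + a) ∸ m ⊓ a ≡ (m ∸ a) ⊓ k
  m⊓[k+a]∸m⊓a≡[m∸a]⊓k zero    k a       rewrite ℕP.0∸n≡0 a = refl
  m⊓[k+a]∸m⊓a≡[m∸a]⊓k (suc m) k zero    = cong (suc m ⊓_) (ℕP.+-identityʳ k)
  m⊓[k+a]∸m⊓a≡[m∸a]⊓k (suc m) k (suc a) =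
    trans (cong (λ j → suc m ⊓ j ∸ suc (m ⊓ a)) (ℕP.+-suc k a)) (m⊓[k+a]∸m⊓a≡[m∸a]⊓k m k a)

  rank-U : (t : ℕ) (X Y : Subset n) → rank (U t X) (Y ∩ X) ≡ t ⊓ ∣ Y ∩ X ∣
  rank-U t X Y = cong (λ Z → t ⊓ ∣ Z ∣) (∩-idemʳ Y X)

  rank-U-free : {t : ℕ} (X Y : Subset n) → ∣ X ∣ ≤ t → rank (U t X) Y ≡ ∣ Y ∩ X ∣
  rank-U-free X Y |X|≤t = ℕP.m≥n⇒m⊓n≡n (ℕP.≤-trans (SubsetP.∣p∩q∣≤∣q∣ Y X) |X|≤t)

  U-restriction : (t : ℕ) (A X : Subset n) → A ⊆ᵇ X ≡ true → (U t X ∣ʳ A) ≈ᴹ U t A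
  U-restriction t A X A⊆X = refl , λ Y → cong (λ Z → t ⊓ ∣ Z ∣) (∩-restrictˡ Y A X A⊆X)

  U-contraction : (t : ℕ) (A X : Subset n) → A ⊆ᵇ X ≡ true → (U t X / A) ≈ᴹ U (t ∸ ∣ A ∣) (X ─ A)
  U-contraction t A X A⊆X = refl , λ Y → begin
    t ⊓ ∣ ((Y ∩ (X ─ A)) ∪ A) ∩ X ∣ ∸ t ⊓ ∣ A ∩ X ∣
      ≡⟨ cong₂ (λ u v → t ⊓ u ∸ t ⊓ v) (∣[Y∩[X─A]∪A]∩X∣≡∣Y∩[X─A]∣+∣A∣ Y A X A⊆X)
                                       (cong ∣_∣ (⊆ᵇ⇒∩≡ A X A⊆X)) ⟩
    t ⊓ (∣ Y ∩ (X ─ A) ∣ + ∣ A ∣) ∸ t ⊓ ∣ A ∣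
      ≡⟨ m⊓[k+a]∸m⊓a≡[m∸a]⊓k t _ _ ⟩
    (t ∸ ∣ A ∣) ⊓ ∣ Y ∩ (X ─ A) ∣
      ∎
    where open ≡-Reasoning

  U-free-split : (t : ℕ) (A X : Subset n) → ∣ X ∣ ≤ t → A ⊆ᵇ X ≡ true →
                 (U t A ⊕ U (t ∸ ∣ A ∣) (X ─ A)) ≈ᴹ U t X
  U-free-split t A X |X|≤t A⊆X = A∪[X─A]≡X A X A⊆X , λ Y → begin
    rank (U t A) (Y ∩ A) + rank (U (t ∸ ∣ A ∣) (X ─ A)) (Y ∩ (X ─ A))
      ≡⟨ cong₂ _+_ (rank-U-free A (Y ∩ A) (ℕP.≤-trans (⊆ᵇ⇒∣∣≤ A X A⊆X) |X|≤t))
                   (rank-U-free (X ─ A) (Y ∩ (X ─ A)) |X─A|≤t∸|A|) ⟩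
    ∣ (Y ∩ A) ∩ A ∣ + ∣ (Y ∩ (X ─ A)) ∩ (X ─ A) ∣
      ≡⟨ cong₂ (λ P Q → ∣ P ∣ + ∣ Q ∣) (∩-idemʳ Y A) (∩-idemʳ Y (X ─ A)) ⟩
    ∣ Y ∩ A ∣ + ∣ Y ∩ (X ─ A) ∣
      ≡⟨ ∣Y∩A∣+∣Y∩[X─A]∣≡∣Y∩X∣ Y A X A⊆X ⟩
    ∣ Y ∩ X ∣
      ≡⟨ rank-U-free X Y |X|≤t ⟨
    rank (U t X) Y
      ∎
    where
    open ≡-Reasoning
    |X─A|≤t∸|A| : ∣ X ─ A ∣ ≤ t ∸ ∣ A ∣
    |X─A|≤t∸|A| = subst (_≤ t ∸ ∣ A ∣)
      (trans (cong (_∸ ∣ A ∣) (sym (∣A∣+∣X─A∣≡∣X∣ A X A⊆X))) (ℕP.m+n∸m≡n ∣ A ∣ ∣ X ─ A ∣))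
      (ℕP.∸-monoˡ-≤ ∣ A ∣ |X|≤t)

module Terms (m : ℕ) where
  open import Data.Nat using (_+_; _∸_; _⊓_)

  Pair : ℕ → Set
  Pair n = Subset n × Subset n

  termIn : Subset n → Pair n → Matroid n
  termIn X (I , L) = (U ∣ I ∣ I ⊕ U (m ∸ ∣ I ∣) L) ⊕ U 0 (X ─ (I ∪ L))

  ground-termIn : (X I L : Subset n) → I ∪ L ⊆ᵇ X ≡ true → ground (termIn X (I , L)) ≡ X
  ground-termIn X I L I∪L⊆X = A∪[X─A]≡X (I ∪ L) X I∪L⊆X

  rank-termIn : (X I L Y : Subset n) → rank (termIn X (I , L)) Y ≡ ∣ Y ∩ I ∣ + (m ∸ ∣ I ∣) ⊓ ∣ Y ∩ L ∣
  rank-termIn {n} X I L Y = trans (ℕP.+-identityʳ _) (cong₂ _+_ rank-I rank-L)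
    where
    Y′ : Subset n
    Y′ = Y ∩ (I ∪ L)
    rank-I : ∣ I ∣ ⊓ ∣ (Y′ ∩ I) ∩ I ∣ ≡ ∣ Y ∩ I ∣
    rank-I = trans (cong (λ Z → ∣ I ∣ ⊓ ∣ Z ∣)
                         (trans (∩-idemʳ Y′ I) (∩-restrictʳ Y (I ∪ L) I (⊆⇒⊆ᵇ I (I ∪ L) (SubsetP.p⊆p∪q L)))))
                   (ℕP.m≥n⇒m⊓n≡n (SubsetP.∣p∩q∣≤∣q∣ Y I))
    rank-L : (m ∸ ∣ I ∣) ⊓ ∣ (Y′ ∩ L) ∩ L ∣ ≡ (m ∸ ∣ I ∣) ⊓ ∣ Y ∩ L ∣
    rank-L = cong (λ Z → (m ∸ ∣ I ∣) ⊓ ∣ Z ∣)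
                  (trans (∩-idemʳ Y′ L) (∩-restrictʳ Y (I ∪ L) L (⊆⇒⊆ᵇ L (I ∪ L) (SubsetP.q⊆p∪q I L))))

  U-split≈termIn : (A X : Subset n) → ∣ A ∣ < m → A ⊆ᵇ X ≡ true →
                   (U m A ⊕ U (m ∸ ∣ A ∣) (X ─ A)) ≈ᴹ termIn X (A , X ─ A)
  U-split≈termIn A X |A|<m A⊆X =
    trans (A∪[X─A]≡X A X A⊆X) (sym (ground-termIn X A (X ─ A) (∪-⊆ᵇ⁺ A (X ─ A) X A⊆X (X─A⊆ᵇX X A)))) ,
    λ Y → begin
      rank (U m A) (Y ∩ A) + rank (U (m ∸ ∣ A ∣) (X ─ A)) (Y ∩ (X ─ A))
        ≡⟨ cong₂ _+_ (rank-U m A Y) (rank-U (m ∸ ∣ A ∣) (X ─ A) Y) ⟩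
      m ⊓ ∣ Y ∩ A ∣ + (m ∸ ∣ A ∣) ⊓ ∣ Y ∩ (X ─ A) ∣
        ≡⟨ cong (_+ (m ∸ ∣ A ∣) ⊓ ∣ Y ∩ (X ─ A) ∣)
                (ℕP.m≥n⇒m⊓n≡n (ℕP.≤-trans (SubsetP.∣p∩q∣≤∣q∣ Y A) (ℕP.<⇒≤ |A|<m))) ⟩
      ∣ Y ∩ A ∣ + (m ∸ ∣ A ∣) ⊓ ∣ Y ∩ (X ─ A) ∣
        ≡⟨ rank-termIn X A (X ─ A) Y ⟨
      rank (termIn X (A , X ─ A)) Y
        ∎
    where open ≡-Reasoning

  termIn-extend : (I L A X : Subset n) → I ∪ L ⊆ᵇ A ≡ true → A ⊆ᵇ X ≡ true → m ≤ ∣ A ∣ →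
                  (termIn A (I , L) ⊕ U (m ∸ ∣ A ∣) (X ─ A)) ≈ᴹ termIn X (I , L)
  termIn-extend {n} I L A X I∪L⊆A A⊆X m≤|A| =
    trans (cong (_∪ (X ─ A)) (ground-termIn A I L I∪L⊆A))
          (trans (A∪[X─A]≡X A X A⊆X) (sym (ground-termIn X I L (⊆ᵇ-trans (I ∪ L) A X I∪L⊆A A⊆X)))) ,
    λ Y → begin
      rank (termIn A (I , L)) (Y ∩ G) + (m ∸ ∣ A ∣) ⊓ ∣ (Y ∩ (X ─ A)) ∩ (X ─ A) ∣
        ≡⟨ cong₂ _+_ (rank-termIn A I L (Y ∩ G))
                     (cong (_⊓ ∣ (Y ∩ (X ─ A)) ∩ (X ─ A) ∣) (ℕP.m≤n⇒m∸n≡0 m≤|A|)) ⟩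
      ∣ (Y ∩ G) ∩ I ∣ + (m ∸ ∣ I ∣) ⊓ ∣ (Y ∩ G) ∩ L ∣ + 0
        ≡⟨ ℕP.+-identityʳ _ ⟩
      ∣ (Y ∩ G) ∩ I ∣ + (m ∸ ∣ I ∣) ⊓ ∣ (Y ∩ G) ∩ L ∣
        ≡⟨ cong₂ (λ P Q → ∣ P ∣ + (m ∸ ∣ I ∣) ⊓ ∣ Q ∣) (∩-restrictʳ Y G I I⊆G) (∩-restrictʳ Y G L L⊆G) ⟩
      ∣ Y ∩ I ∣ + (m ∸ ∣ I ∣) ⊓ ∣ Y ∩ L ∣
        ≡⟨ rank-termIn X I L Y ⟨
      rank (termIn X (I , L)) Y
        ∎
    where
    open ≡-Reasoning
    G : Subset n
    G = ground (termIn A (I , L))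
    G≡A : G ≡ A
    G≡A = ground-termIn A I L I∪L⊆A
    I⊆G : I ⊆ᵇ G ≡ true
    I⊆G = subst (λ Z → I ⊆ᵇ Z ≡ true) (sym G≡A) (proj₁ (∪-⊆ᵇ⁻ I L A I∪L⊆A))
    L⊆G : L ⊆ᵇ G ≡ true
    L⊆G = subst (λ Z → L ⊆ᵇ Z ≡ true) (sym G≡A) (proj₂ (∪-⊆ᵇ⁻ I L A I∪L⊆A))

  U≈termIn-last : (X : Subset n) → 1 ≤ m → ∣ X ∣ ≡ m →
                  U m X ≈ᴹ termIn X (X ─ ⁅last X ⁆ , ⁅last X ⁆)
  U≈termIn-last {n} X 1≤m |X|≡m =
    sym (ground-termIn X (X ─ x) x (∪-⊆ᵇ⁺ (X ─ x) x X (X─A⊆ᵇX X x) (⁅last⁆⊆ᵇ X))) ,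
    λ Y → begin
      m ⊓ ∣ Y ∩ X ∣
        ≡⟨ rank-U-free X Y (ℕP.≤-reflexive |X|≡m) ⟩
      ∣ Y ∩ X ∣
        ≡⟨ ∣Y∩A∣+∣Y∩[X─A]∣≡∣Y∩X∣ Y x X (⁅last⁆⊆ᵇ X) ⟨
      ∣ Y ∩ x ∣ + ∣ Y ∩ (X ─ x) ∣
        ≡⟨ ℕP.+-comm ∣ Y ∩ x ∣ ∣ Y ∩ (X ─ x) ∣ ⟩
      ∣ Y ∩ (X ─ x) ∣ + ∣ Y ∩ x ∣
        ≡⟨ cong (_+_ ∣ Y ∩ (X ─ x) ∣) (rank-U-free x Y (ℕP.≤-reflexive (trans |x|≡1 (sym m∸|X─x|≡1)))) ⟨
      ∣ Y ∩ (X ─ x) ∣ + (m ∸ ∣ X ─ x ∣) ⊓ ∣ Y ∩ x ∣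
        ≡⟨ rank-termIn X (X ─ x) x Y ⟨
      rank (termIn X (X ─ x , x)) Y
        ∎
    where
    open ≡-Reasoning
    x : Subset n
    x = ⁅last X ⁆
    |x|≡1 : ∣ x ∣ ≡ 1
    |x|≡1 = ∣⁅last⁆∣≡1 X (subst (1 ≤_) (sym |X|≡m) 1≤m)
    m∸|X─x|≡1 : m ∸ ∣ X ─ x ∣ ≡ 1
    m∸|X─x|≡1 = begin
      m ∸ ∣ X ─ x ∣               ≡⟨ cong (_∸ ∣ X ─ x ∣) (sym (trans (∣A∣+∣X─A∣≡∣X∣ x X (⁅last⁆⊆ᵇ X)) |X|≡m)) ⟩
      ∣ x ∣ + ∣ X ─ x ∣ ∸ ∣ X ─ x ∣ ≡⟨ ℕP.m+n∸n≡m ∣ x ∣ ∣ X ─ x ∣ ⟩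
      ∣ x ∣                       ≡⟨ |x|≡1 ⟩
      1                           ∎

-- The coefficients in the recursion for S(U^m_X)

module Recursion (n m : ℕ) where
  open import Data.Integer using (_+_; _-_; _*_; -_)
  open Terms m

  pairs : List (Pair n)
  pairs = cartesianProduct (allSubsets n) (allSubsets n)

  _≟ᵖ_ : DecidableEquality (Pair n)
  (I , L) ≟ᵖ (I′ , L′) =
    map′ (λ e → cong₂ _,_ (proj₁ e) (proj₂ e)) (λ e → cong proj₁ e , cong proj₂ e)
         (≡-dec Bool._≟_ I I′ ×-dec ≡-dec Bool._≟_ L L′)

  open Coefficients _≟ᵖ_

  ∑-pairs-δ : (f : Pair n → ℤ) (l : Pair n) → ∑[ p ∈ pairs ] [ does (p ≟ᵖ l) ]* f p ≡ f l
  ∑-pairs-δ f (I , L) = begin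
    ∑[ p ∈ pairs ] [ does (p ≟ᵖ (I , L)) ]* f p
      ≡⟨ ∑-cartesianProduct (allSubsets n) (allSubsets n) _ ⟩
    ∑[ a ∈ allSubsets n ] ∑[ b ∈ allSubsets n ] [ (a ≡ᵇ I) ∧ (b ≡ᵇ L) ]* f (a , b)
      ≡⟨ ∑-cong (allSubsets n) (λ a → ∑-cong (allSubsets n) λ b →
           trans ([]*-∧ (a ≡ᵇ I) (b ≡ᵇ L) _) ([]*-comm (a ≡ᵇ I) (b ≡ᵇ L) _)) ⟩
    ∑[ a ∈ allSubsets n ] ∑[ b ∈ allSubsets n ] [ b ≡ᵇ L ]* [ a ≡ᵇ I ]* f (a , b)
      ≡⟨ ∑-cong (allSubsets n) (λ a → ∑-δ L λ b → [ a ≡ᵇ I ]* f (a , b)) ⟩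
    ∑[ a ∈ allSubsets n ] [ a ≡ᵇ I ]* f (a , L)
      ≡⟨ ∑-δ I (λ a → f (a , L)) ⟩
    f (I , L)
      ∎
    where open ≡-Reasoning

  coeff-select : {P : Pair n → Set} (P? : (p : Pair n) → Dec (P p)) (f : Pair n → ℤ) (l : Pair n) →
                 coeff (map (λ p → f p , p) (filter P? pairs)) l ≡ [ does (P? l) ]* f l
  coeff-select P? f l = begin
    coeff (map (λ p → f p , p) (filter P? pairs)) l
      ≡⟨ ∑-map _ (filter P? pairs) _ ⟩
    ∑[ p ∈ filter P? pairs ] [ does (p ≟ᵖ l) ]* f p
      ≡⟨ ∑-filter P? pairs _ ⟩
    ∑[ p ∈ pairs ] [ does (P? p) ]* [ does (p ≟ᵖ l) ]* f p
      ≡⟨ ∑-cong pairs (λ p → []*-comm (does (P? p)) (does (p ≟ᵖ l)) (f p)) ⟩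
    ∑[ p ∈ pairs ] [ does (p ≟ᵖ l) ]* [ does (P? p) ]* f p
      ≡⟨ ∑-pairs-δ (λ p → [ does (P? p) ]* f p) l ⟩
    [ does (P? l) ]* f l
      ∎
    where open ≡-Reasoning

  ValidIn : Subset n → Pair n → Set
  ValidIn X (I , L) = I ∪ L ⊆ X × Valid m I L

  validIn? : (X : Subset n) (p : Pair n) → Dec (ValidIn X p)
  validIn? X (I , L) = (I ∪ L) SubsetP.⊆? X ×-dec valid? m I L

  signIn : Subset n → Pair n → ℤ
  signIn X (_ , L) = -1^ (∣ X ∣ ℕ.∸ ∣ L ∣ ℕ.+ 1)

  formulaIn : Subset n → List (ℤ × Pair n)
  formulaIn X = map (λ p → signIn X p , p) (filter (validIn? X) pairs)

  coeff-formulaIn : ∀ X l → coeff (formulaIn X) l ≡ [ does (validIn? X l) ]* signIn X l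
  coeff-formulaIn X = coeff-select (validIn? X) (signIn X)

  validIn⇒ : ∀ X I L → does (validIn? X (I , L)) ≡ true → I ∪ L ⊆ᵇ X ≡ true × Valid m I L
  validIn⇒ X I L h = proj₁ h′ , does⇒ (valid? m I L) (proj₂ h′)
    where
    h′ : I ∪ L ⊆ᵇ X ≡ true × does (valid? m I L) ≡ true
    h′ = ∧-true⁻ (I ∪ L ⊆ᵇ X) (does (valid? m I L)) h

  validIn-mono : ∀ A X l → A ⊆ᵇ X ≡ true → does (validIn? A l) ≡ true → does (validIn? X l) ≡ true
  validIn-mono A X (I , L) A⊆X h = dec-true (validIn? X (I , L))
    (⊆ᵇ⇒⊆ (I ∪ L) X (⊆ᵇ-trans (I ∪ L) A X (proj₁ (validIn⇒ A I L h)) A⊆X) , proj₂ (validIn⇒ A I L h))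

  validIn-complement : ∀ A X → A ⊆ᵇ X ≡ true → ∣ A ∣ < m → m < ∣ X ∣ → does (validIn? X (A , X ─ A)) ≡ true
  validIn-complement A X A⊆X |A|<m m<|X| = dec-true (validIn? X (A , X ─ A))
    ( ⊆ᵇ⇒⊆ (A ∪ (X ─ A)) X (∪-⊆ᵇ⁺ A (X ─ A) X A⊆X (X─A⊆ᵇX X A))
    , Disjoint-A-[X─A] A X
    , |A|<m
    , ℕP.≤-trans (ℕP.<⇒≤ m<|X|) (ℕP.≤-reflexive (sym (∣A∣+∣X─A∣≡∣X∣ A X A⊆X)))
    , λ |A|+|X─A|≡m → contradiction (trans (sym |A|+|X─A|≡m) (∣A∣+∣X─A∣≡∣X∣ A X A⊆X)) (ℕP.<⇒≢ m<|X|)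
    )

  -- S(U^m_A) ⊕ U^{m-|A|}_{X∖A}, in the form given by induction on |A|
  contribution : Subset n → Subset n → List (ℤ × Pair n)
  contribution X A with ∣ A ∣ ℕP.<? m
  ... | yes _ = (-1^ ∣ A ∣ , (A , X ─ A)) ∷ []
  ... | no  _ = formulaIn A

  recursionSum : Subset n → List (ℤ × Pair n)
  recursionSum X = negate (concatMap (contribution X) (properSubsets X))

  coeff-recursionSum : ∀ X l →
    coeff (recursionSum X) l ≡ - (∑[ A ∈ allSubsets n ] [ A ⊂ᵇ X ]* coeff (contribution X A) l)
  coeff-recursionSum X l =
    trans (coeff-negate (concatMap (contribution X) (properSubsets X)) l)
          (cong (λ z → - z) (trans (coeff-concatMap (contribution X) (properSubsets X) l)
                          (∑-filter (λ A → A SubsetP.⊂? X) (allSubsets n) _)))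

  contribution-invalid : ∀ X l A → m < ∣ X ∣ → does (validIn? X l) ≡ false →
                         [ A ⊂ᵇ X ]* coeff (contribution X A) l ≡ + 0
  contribution-invalid X (I , L) A m<|X| invalid with ∣ A ∣ ℕP.<? m
  ... | yes |A|<m with A ⊂ᵇ X in A⊂X | A ≡ᵇ I in A≡I | X ─ A ≡ᵇ L in X─A≡L
  ...   | false | _     | _     = refl
  ...   | true  | false | _     = refl
  ...   | true  | true  | false = refl
  ...   | true  | true  | true  = contradiction
    (subst₂ (λ I L → does (validIn? X (I , L)) ≡ true) (≡ᵇ⇒≡ A I A≡I) (≡ᵇ⇒≡ (X ─ A) L X─A≡L)
            (validIn-complement A X (⊂ᵇ⇒⊆ᵇ A X A⊂X) |A|<m m<|X|))
    (λ valid → true≢false (trans (sym valid) invalid))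
  contribution-invalid X (I , L) A m<|X| invalid | no _
    rewrite coeff-formulaIn A (I , L) with A ⊂ᵇ X in A⊂X | does (validIn? A (I , L)) in validA
  ... | false | _     = refl
  ... | true  | false = refl
  ... | true  | true  =
    contradiction (validIn-mono A X (I , L) (⊂ᵇ⇒⊆ᵇ A X A⊂X) validA) (λ valid → true≢false (trans (sym valid) invalid))

  -- The coefficient of a valid pair (I, L) of X in the recursion: with
  -- S = I ∪ L, the summand of A is [A = I] K + [A ⊊ X][S ⊆ A] w(A), and the
  -- second part sums to an alternating sum over S ⊆ A ⊆ X.
  module ValidPair (X I L : Subset n) (m<|X| : m < ∣ X ∣) (valid : does (validIn? X (I , L)) ≡ true) where
    S : Subset n
    S = I ∪ L
    S⊆X : S ⊆ᵇ X ≡ true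
    S⊆X = proj₁ (validIn⇒ X I L valid)
    V : Valid m I L
    V = proj₂ (validIn⇒ X I L valid)
    I⊆X : I ⊆ᵇ X ≡ true
    I⊆X = proj₁ (∪-⊆ᵇ⁻ I L X S⊆X)
    L⊆X : L ⊆ᵇ X ≡ true
    L⊆X = proj₂ (∪-⊆ᵇ⁻ I L X S⊆X)
    I#L : disjointᵇ I L ≡ true
    I#L = Disjoint⇒disjointᵇ I L (proj₁ V)
    |I|<m : ∣ I ∣ < m
    |I|<m = proj₁ (proj₂ V)
    m≤|S| : m ≤ ∣ S ∣
    m≤|S| = subst (m ≤_) (sym (∣I∪L∣≡∣I∣+∣L∣ I L I#L)) (proj₁ (proj₂ (proj₂ V)))

    b : ℤ
    b = -1^ ∣ L ∣
    w : Subset n → ℤ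
    w A = - (b * -1^ ∣ A ∣)
    K : ℤ
    K = [ S ≡ᵇ X ]* -1^ ∣ I ∣

    validIn-at : ∀ A → does (validIn? A (I , L)) ≡ S ⊆ᵇ A
    validIn-at A = trans (cong ((S ⊆ᵇ A) ∧_) (proj₂ (∧-true⁻ (S ⊆ᵇ X) _ valid))) (BoolP.∧-identityʳ _)

    contribution-valid : ∀ A → [ A ⊂ᵇ X ]* coeff (contribution X A) (I , L)
                               ≡ [ A ≡ᵇ I ]* K + [ A ⊂ᵇ X ]* [ S ⊆ᵇ A ]* w A
    contribution-valid A with ∣ A ∣ ℕP.<? m
    ... | yes |A|<m with S ⊆ᵇ A in S⊆A
    ...   | true  = contradiction (ℕP.≤-trans m≤|S| (⊆ᵇ⇒∣∣≤ S A S⊆A)) (ℕP.<⇒≱ |A|<m)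
    ...   | false rewrite []*-zero (A ⊂ᵇ X) with A ≡ᵇ I in A≡I
    ...     | false = []*-zero (A ⊂ᵇ X)
    ...     | true with refl ← ≡ᵇ⇒≡ A I A≡I
      rewrite [X─I≡ᵇL]≡[I∪L≡ᵇX] I L X I⊆X L⊆X I#L | ⊆ᵇ∧∣∣<⇒⊂ᵇ I X I⊆X (ℕP.<-trans |I|<m m<|X|) = refl
    contribution-valid A | no |A|≮m rewrite coeff-formulaIn A (I , L) | validIn-at A with A ≡ᵇ I in A≡I
    ... | true  with refl ← ≡ᵇ⇒≡ A I A≡I = contradiction |I|<m |A|≮m
    ... | false with S ⊆ᵇ A in S⊆A
    ...   | false = sym (ℤP.+-identityˡ _)
    ...   | true  = trans (cong [ A ⊂ᵇ X ]*_ (-1^[a∸b+1] ∣ A ∣ ∣ L ∣ (⊆ᵇ⇒∣∣≤ L A (proj₂ (∪-⊆ᵇ⁻ I L A S⊆A)))))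
                          (sym (ℤP.+-identityˡ _))

    ∑-strict-supersets : ∑[ A ∈ allSubsets n ] [ A ⊂ᵇ X ]* [ S ⊆ᵇ A ]* w A ≡ (- b) * [ S ≡ᵇ X ]* -1^ ∣ X ∣ - w X
    ∑-strict-supersets = begin
      ∑[ A ∈ allSubsets n ] [ A ⊂ᵇ X ]* [ S ⊆ᵇ A ]* w A
        ≡⟨ ∑-cong (allSubsets n) (λ A → [⊂ᵇ]≡[⊆ᵇ]-[≡ᵇ] A X _) ⟩
      ∑[ A ∈ allSubsets n ] ([ A ⊆ᵇ X ]* [ S ⊆ᵇ A ]* w A - [ A ≡ᵇ X ]* [ S ⊆ᵇ A ]* w A)
        ≡⟨ ∑-distrib-+ (allSubsets n) _ _ ⟩
      ∑[ A ∈ allSubsets n ] [ A ⊆ᵇ X ]* [ S ⊆ᵇ A ]* w A + ∑[ A ∈ allSubsets n ] (- [ A ≡ᵇ X ]* [ S ⊆ᵇ A ]* w A)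
        ≡⟨ cong₂ _+_ ∑-supersets (trans (∑-neg (allSubsets n) _) (cong (λ z → - z) (∑-δ X (λ A → [ S ⊆ᵇ A ]* w A)))) ⟩
      (- b) * [ S ≡ᵇ X ]* -1^ ∣ X ∣ - [ S ⊆ᵇ X ]* w X
        ≡⟨ cong (λ s → (- b) * [ S ≡ᵇ X ]* -1^ ∣ X ∣ - [ s ]* w X) S⊆X ⟩
      (- b) * [ S ≡ᵇ X ]* -1^ ∣ X ∣ - w X
        ∎
      where
      open ≡-Reasoning
      ∑-supersets : ∑[ A ∈ allSubsets n ] [ A ⊆ᵇ X ]* [ S ⊆ᵇ A ]* w A ≡ (- b) * [ S ≡ᵇ X ]* -1^ ∣ X ∣
      ∑-supersets = begin
        ∑[ A ∈ allSubsets n ] [ A ⊆ᵇ X ]* [ S ⊆ᵇ A ]* w A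
          ≡⟨ ∑-cong (allSubsets n) (λ A → trans ([]*-comm (A ⊆ᵇ X) (S ⊆ᵇ A) _) (sym ([]*-∧ (S ⊆ᵇ A) (A ⊆ᵇ X) _))) ⟩
        ∑[ A ∈ allSubsets n ] [ (S ⊆ᵇ A) ∧ (A ⊆ᵇ X) ]* w A
          ≡⟨ ∑-cong (allSubsets n) (λ A →
               trans (cong [ (S ⊆ᵇ A) ∧ (A ⊆ᵇ X) ]*_ (ℤP.neg-distribˡ-* b (-1^ ∣ A ∣)))
                     ([]*-* ((S ⊆ᵇ A) ∧ (A ⊆ᵇ X)) (- b) (-1^ ∣ A ∣))) ⟩
        ∑[ A ∈ allSubsets n ] ((- b) * [ (S ⊆ᵇ A) ∧ (A ⊆ᵇ X) ]* -1^ ∣ A ∣)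
          ≡⟨ *-distribˡ-∑ (- b) (allSubsets n) _ ⟩
        (- b) * (∑[ A ∈ allSubsets n ] [ (S ⊆ᵇ A) ∧ (A ⊆ᵇ X) ]* -1^ ∣ A ∣)
          ≡⟨ cong ((- b) *_) (∑-alternating S X) ⟩
        (- b) * [ S ≡ᵇ X ]* -1^ ∣ X ∣
          ∎

    coeff-recursion-valid : coeff (recursionSum X) (I , L) ≡ coeff (formulaIn X) (I , L)
    coeff-recursion-valid = begin
      coeff (recursionSum X) (I , L)
        ≡⟨ coeff-recursionSum X (I , L) ⟩
      - (∑[ A ∈ allSubsets n ] [ A ⊂ᵇ X ]* coeff (contribution X A) (I , L))
        ≡⟨ cong (λ z → - z) (∑-cong (allSubsets n) contribution-valid) ⟩
      - (∑[ A ∈ allSubsets n ] ([ A ≡ᵇ I ]* K + [ A ⊂ᵇ X ]* [ S ⊆ᵇ A ]* w A))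
        ≡⟨ cong (λ z → - z) (∑-distrib-+ (allSubsets n) _ _) ⟩
      - (∑[ A ∈ allSubsets n ] [ A ≡ᵇ I ]* K + ∑[ A ∈ allSubsets n ] [ A ⊂ᵇ X ]* [ S ⊆ᵇ A ]* w A)
        ≡⟨ cong (λ z → - z) (cong₂ _+_ (∑-δ I (λ _ → K)) ∑-strict-supersets) ⟩
      - (K + ((- b) * [ S ≡ᵇ X ]* -1^ ∣ X ∣ - w X))
        ≡⟨ cancel ⟩
      w X
        ≡⟨ -1^[a∸b+1] ∣ X ∣ ∣ L ∣ (⊆ᵇ⇒∣∣≤ L X L⊆X) ⟨
      signIn X (I , L)
        ≡⟨ cong (λ v → [ v ]* signIn X (I , L)) valid ⟨
      [ does (validIn? X (I , L)) ]* signIn X (I , L)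
        ≡⟨ coeff-formulaIn X (I , L) ⟨
      coeff (formulaIn X) (I , L)
        ∎
      where
      open ≡-Reasoning
      cancel : - (K + ((- b) * [ S ≡ᵇ X ]* -1^ ∣ X ∣ - w X)) ≡ w X
      cancel with S ≡ᵇ X in S≡X
      ... | false = lemma b (-1^ ∣ X ∣)
        where
        lemma : ∀ b c → - (+ 0 + ((- b) * + 0 - - (b * c))) ≡ - (b * c)
        lemma = solve-∀
      ... | true = begin
        - (a + ((- b) * c - - (b * c))) ≡⟨ lemma a b c ⟩
        - a                              ≡⟨ cong (λ z → - z) (sym (ℤP.*-identityʳ a)) ⟩
        - (a * + 1)                      ≡⟨ cong (λ z → - (a * z)) (sym (-1^-square ∣ L ∣)) ⟩
        - (a * (b * b))                  ≡⟨ cong (λ z → - z) (lemma′ a b) ⟩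
        - (b * (a * b))                  ≡⟨ cong (λ z → - (b * z)) (sym (-1^-+ ∣ I ∣ ∣ L ∣)) ⟩
        - (b * -1^ (∣ I ∣ ℕ.+ ∣ L ∣))   ≡⟨ cong (λ k → - (b * -1^ k)) |I|+|L|≡|X| ⟩
        - (b * c)                        ∎
        where
        a c : ℤ
        a = -1^ ∣ I ∣
        c = -1^ ∣ X ∣
        |I|+|L|≡|X| : ∣ I ∣ ℕ.+ ∣ L ∣ ≡ ∣ X ∣
        |I|+|L|≡|X| = trans (sym (∣I∪L∣≡∣I∣+∣L∣ I L I#L)) (cong ∣_∣ (≡ᵇ⇒≡ S X S≡X))
        lemma : ∀ a b c → - (a + ((- b) * c - - (b * c))) ≡ - a
        lemma = solve-∀
        lemma′ : ∀ a b → a * (b * b) ≡ b * (a * b)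
        lemma′ = solve-∀

  coeff-recursion : ∀ X → m < ∣ X ∣ → ∀ l → coeff (recursionSum X) l ≡ coeff (formulaIn X) l
  coeff-recursion X m<|X| (I , L) with does (validIn? X (I , L)) in valid
  ... | true  = ValidPair.coeff-recursion-valid X I L m<|X| valid
  ... | false = begin
    coeff (recursionSum X) (I , L)
      ≡⟨ coeff-recursionSum X (I , L) ⟩
    - (∑[ A ∈ allSubsets n ] [ A ⊂ᵇ X ]* coeff (contribution X A) (I , L))
      ≡⟨ cong (λ z → - z) (∑-zero (allSubsets n) λ A → contribution-invalid X (I , L) A m<|X| valid) ⟩
    + 0
      ≡⟨ cong (λ v → [ v ]* signIn X (I , L)) valid ⟨
    [ does (validIn? X (I , L)) ]* signIn X (I , L)
      ≡⟨ coeff-formulaIn X (I , L) ⟨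
    coeff (formulaIn X) (I , L)
      ∎
    where open ≡-Reasoning

  module Tie (X : Subset n) (1≤m : 1 ≤ m) (|X|≡m : ∣ X ∣ ≡ m) where
    x : Subset n
    x = ⁅last X ⁆

    lastPair : Pair n
    lastPair = X ─ x , x

    x⊆X : x ⊆ᵇ X ≡ true
    x⊆X = ⁅last⁆⊆ᵇ X
    1≤|X| : 1 ≤ ∣ X ∣
    1≤|X| = subst (1 ≤_) (sym |X|≡m) 1≤m
    |x|≡1 : ∣ x ∣ ≡ 1
    |x|≡1 = ∣⁅last⁆∣≡1 X 1≤|X|
    1+|X─x|≡m : 1 ℕ.+ ∣ X ─ x ∣ ≡ m
    1+|X─x|≡m = trans (cong (ℕ._+ ∣ X ─ x ∣) (sym |x|≡1)) (trans (∣A∣+∣X─A∣≡∣X∣ x X x⊆X) |X|≡m)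

    lastPair-valid : ValidIn X lastPair
    lastPair-valid =
        ⊆ᵇ⇒⊆ ((X ─ x) ∪ x) X (∪-⊆ᵇ⁺ (X ─ x) x X (X─A⊆ᵇX X x) x⊆X)
      , Disjoint-[X─L]-L x X
      , ℕP.≤-reflexive 1+|X─x|≡m
      , ℕP.≤-reflexive (sym (trans (cong (ℕ._+_ ∣ X ─ x ∣) |x|≡1) (trans (ℕP.+-comm _ 1) 1+|X─x|≡m)))
      , λ _ → |x|≡1 , ⁅last⁆-max X

    valid⇒lastPair : ∀ l → ValidIn X l → l ≡ lastPair
    valid⇒lastPair (I , L) (I∪L⊆X , I#L , _ , m≤|I|+|L| , tie) = cong₂ _,_ I≡X─x L≡x
      where
      |I∪L|≡ : ∣ I ∪ L ∣ ≡ ∣ I ∣ ℕ.+ ∣ L ∣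
      |I∪L|≡ = ∣I∪L∣≡∣I∣+∣L∣ I L (Disjoint⇒disjointᵇ I L I#L)
      I∪L≡X : I ∪ L ≡ X
      I∪L≡X = ⊆ᵇ∧∣∣≥⇒≡ (I ∪ L) X (⊆⇒⊆ᵇ (I ∪ L) X I∪L⊆X)
                (subst₂ _≤_ (sym |X|≡m) (sym |I∪L|≡) m≤|I|+|L|)
      last-of-L : ∣ L ∣ ≡ 1 × (∀ i l → i ∈ I → l ∈ L → i <ᶠ l)
      last-of-L = tie (trans (sym |I∪L|≡) (trans (cong ∣_∣ I∪L≡X) |X|≡m))
      L≡x : L ≡ x
      L≡x = trans (⁅last⁆-unique I L (proj₁ last-of-L) (proj₂ last-of-L)) (cong ⁅last_⁆ I∪L≡X)
      I≡X─x : I ≡ X ─ x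
      I≡X─x = trans (I≡[I∪L]─L I L (Disjoint⇒disjointᵇ I L I#L)) (cong₂ _─_ I∪L≡X L≡x)

    coeff-formulaIn-tie : ∀ l → coeff (formulaIn X) l ≡ coeff ((-1^ ∣ X ∣ , lastPair) ∷ []) l
    coeff-formulaIn-tie l rewrite coeff-formulaIn X l with does (validIn? X l) in valid
    ... | true with refl ← valid⇒lastPair l (does⇒ (validIn? X l) valid)
      rewrite dec-true (lastPair ≟ᵖ lastPair) refl =
      trans (cong -1^_ (trans (cong (λ k → ∣ X ∣ ℕ.∸ k ℕ.+ 1) |x|≡1) (ℕP.m∸n+n≡m 1≤|X|)))
            (sym (ℤP.+-identityʳ _))
    ... | false rewrite dec-false (lastPair ≟ᵖ l) (λ eq → true≢false (trans (sym (dec-true (validIn? X l)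
                                                    (subst (ValidIn X) eq lastPair-valid))) valid)) = refl

-- The antipode of U^m_X

module Antipode {c ℓ₁ ℓ₂} (K : HeytingField c ℓ₁ ℓ₂) (n m : ℕ) (1≤m : 1 ≤ m) where
  open import Data.Nat using (_∸_)
  open Over K n
  open Combinations K n
  open Terms m
  open Recursion n m
  open Coefficients _≟ᵖ_ using (coeff)
  open CommutativeRing (HeytingCommutativeRing.commutativeRing (HeytingField.heytingCommutativeRing K))
    using () renaming (refl to ≈-refl; sym to ≈-sym; reflexive to ≈-reflexive)

  module ByPair (X : Subset n) = Labelled _≟ᵖ_ (termIn X)
  module Single (X : Subset n) = Labelled UnitP._≟_ (λ _ → U m X)

  expected : Subset n → Comb
  expected X with ∣ X ∣ ℕP.<? m
  ... | yes _ = (sgn ∣ X ∣ , U m X) ∷ []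
  ... | no  _ = ByPair.realize X (formulaIn X)

  Rest : Subset n → Comb
  Rest X = concatMap (λ A → expected A ⊕ᶜ U (m ∸ ∣ A ∣) (X ─ A)) (properSubsets X)

  open Coefficients UnitP._≟_ using () renaming (coeff to coeff′; negate to negate′;
    coeff-negate to coeff-negate′; coeff-concatMap to coeff-concatMap′)

  single : Subset n → List (ℤ × _)
  single A = (-1^ ∣ A ∣ , tt) ∷ []

  coeff-free : ∀ X → 1 ≤ ∣ X ∣ →
            coeff′ (negate′ (concatMap single (properSubsets X))) tt ≡ coeff′ ((-1^ ∣ X ∣ , tt) ∷ []) tt
  coeff-free X 1≤|X| = begin
    coeff′ (negate′ (concatMap single (properSubsets X))) tt
      ≡⟨ coeff-negate′ (concatMap single (properSubsets X)) tt ⟩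
    ℤ.- coeff′ (concatMap single (properSubsets X)) tt
      ≡⟨ cong ℤ.-_ (coeff-concatMap′ single (properSubsets X) tt) ⟩
    ℤ.- (∑[ A ∈ properSubsets X ] (-1^ ∣ A ∣ ℤ.+ + 0))
      ≡⟨ cong ℤ.-_ (∑-filter (λ A → A SubsetP.⊂? X) (allSubsets n) _) ⟩
    ℤ.- (∑[ A ∈ allSubsets n ] [ A ⊂ᵇ X ]* (-1^ ∣ A ∣ ℤ.+ + 0))
      ≡⟨ cong ℤ.-_ (∑-cong (allSubsets n) λ A → cong [ A ⊂ᵇ X ]*_ (ℤP.+-identityʳ _)) ⟩
    ℤ.- (∑[ A ∈ allSubsets n ] [ A ⊂ᵇ X ]* -1^ ∣ A ∣)
      ≡⟨ cong ℤ.-_ (∑-proper-subsets X 1≤|X|) ⟩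
    ℤ.- ℤ.- -1^ ∣ X ∣
      ≡⟨ ℤP.neg-involutive _ ⟩
    -1^ ∣ X ∣
      ≡⟨ ℤP.+-identityʳ _ ⟨
    -1^ ∣ X ∣ ℤ.+ + 0
      ∎
    where open ≡-Reasoning

  free-step : ∀ X → ∣ X ∣ ≤ m → 1 ≤ ∣ X ∣ → negC (Rest X) ≈ᶜ (⟦ -1^ ∣ X ∣ ⟧ , U m X) ∷ []
  free-step X |X|≤m 1≤|X| = begin
    negC (Rest X)
      ≈⟨ negC⁺ (concatMap-filter⁺ (λ A → A SubsetP.⊂? X) (allSubsets n) term≈) ⟩
    negC (concatMap (Single.realize X ∘ single) (properSubsets X))
      ≡⟨ cong negC (Single.concatMap-realize X single (properSubsets X)) ⟩
    negC (Single.realize X (concatMap single (properSubsets X)))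
      ≈⟨ ≈ᵖ⇒≈ᶜ (Single.negC-realize X _) ⟩
    Single.realize X (negate′ (concatMap single (properSubsets X)))
      ≈⟨ Single.coeff≗⇒≈ᶜ X _ ((-1^ ∣ X ∣ , tt) ∷ []) (λ _ → coeff-free X 1≤|X|) ⟩
    (⟦ -1^ ∣ X ∣ ⟧ , U m X) ∷ []
      ∎
    where
    open ≈ᶜ-Reasoning
    term≈ : ∀ A → A ⊂ X → expected A ⊕ᶜ U (m ∸ ∣ A ∣) (X ─ A) ≈ᶜ Single.realize X (single A)
    term≈ A A⊂X with ∣ A ∣ ℕP.<? m
    ... | yes _ = ≈ᵖ⇒≈ᶜ ((≈-sym (⟦-1^⟧ ∣ A ∣) , U-free-split m A X |X|≤m (⊆⇒⊆ᵇ A X (proj₁ A⊂X))) ∷ [])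
    ... | no |A|≮m = contradiction (ℕP.<-≤-trans (SubsetP.p⊂q⇒∣p∣<∣q∣ A⊂X) |X|≤m) |A|≮m

  formula⊕U≈formula : ∀ A X → A ⊆ᵇ X ≡ true → m ≤ ∣ A ∣ → ∀ ps →
    ByPair.realize A (map (λ p → signIn A p , p) (filter (validIn? A) ps)) ⊕ᶜ U (m ∸ ∣ A ∣) (X ─ A)
      ≈ᵖ ByPair.realize X (map (λ p → signIn A p , p) (filter (validIn? A) ps))
  formula⊕U≈formula A X A⊆X m≤|A| []             = []
  formula⊕U≈formula A X A⊆X m≤|A| ((I , L) ∷ ps) with does (validIn? A (I , L)) in valid
  ... | true  = (≈-refl , termIn-extend I L A X (proj₁ (validIn⇒ A I L valid)) A⊆X m≤|A|)
                ∷ formula⊕U≈formula A X A⊆X m≤|A| ps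
  ... | false = formula⊕U≈formula A X A⊆X m≤|A| ps

  generic-step : ∀ X → m < ∣ X ∣ → negC (Rest X) ≈ᶜ ByPair.realize X (formulaIn X)
  generic-step X m<|X| = begin
    negC (Rest X)
      ≈⟨ negC⁺ (concatMap-filter⁺ (λ A → A SubsetP.⊂? X) (allSubsets n) term≈) ⟩
    negC (concatMap (ByPair.realize X ∘ contribution X) (properSubsets X))
      ≡⟨ cong negC (ByPair.concatMap-realize X (contribution X) (properSubsets X)) ⟩
    negC (ByPair.realize X (concatMap (contribution X) (properSubsets X)))
      ≈⟨ ≈ᵖ⇒≈ᶜ (ByPair.negC-realize X _) ⟩
    ByPair.realize X (recursionSum X)
      ≈⟨ ByPair.coeff≗⇒≈ᶜ X _ _ (coeff-recursion X m<|X|) ⟩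
    ByPair.realize X (formulaIn X)
      ∎
    where
    open ≈ᶜ-Reasoning
    term≈ : ∀ A → A ⊂ X → expected A ⊕ᶜ U (m ∸ ∣ A ∣) (X ─ A) ≈ᶜ ByPair.realize X (contribution X A)
    term≈ A A⊂X with ∣ A ∣ ℕP.<? m
    ... | yes |A|<m = ≈ᵖ⇒≈ᶜ ((≈-sym (⟦-1^⟧ ∣ A ∣) , U-split≈termIn A X |A|<m A⊆X) ∷ [])
      where A⊆X = ⊆⇒⊆ᵇ A X (proj₁ A⊂X)
    ... | no  |A|≮m = ≈ᵖ⇒≈ᶜ (formula⊕U≈formula A X (⊆⇒⊆ᵇ A X (proj₁ A⊂X)) (ℕP.≮⇒≥ |A|≮m) pairs)

  tie-step : ∀ X → ∣ X ∣ ≡ m → negC (Rest X) ≈ᶜ ByPair.realize X (formulaIn X)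
  tie-step X |X|≡m = begin
    negC (Rest X)
      ≈⟨ free-step X (ℕP.≤-reflexive |X|≡m) 1≤|X| ⟩
    (⟦ -1^ ∣ X ∣ ⟧ , U m X) ∷ []
      ≈⟨ ≈ᶜ-term [] ≈-refl (U≈termIn-last X 1≤m |X|≡m) ⟩
    ByPair.realize X ((-1^ ∣ X ∣ , lastPair) ∷ [])
      ≈⟨ ByPair.coeff≗⇒≈ᶜ X _ (formulaIn X) (λ l → sym (coeff-formulaIn-tie l)) ⟩
    ByPair.realize X (formulaIn X)
      ∎
    where
    open ≈ᶜ-Reasoning
    open Tie X 1≤m |X|≡m

  recursion-step : ∀ X → 1 ≤ ∣ X ∣ → negC (Rest X) ≈ᶜ expected X
  recursion-step X 1≤|X| with ∣ X ∣ ℕP.<? m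
  ... | yes |X|<m = ≈ᶜ-trans (free-step X (ℕP.<⇒≤ |X|<m) 1≤|X|) (≈ᶜ-term [] (⟦-1^⟧ ∣ X ∣) ≈ᴹ-refl)
  ... | no  |X|≮m with ∣ X ∣ ℕ.≟ m
  ...   | yes |X|≡m = tie-step X |X|≡m
  ...   | no  |X|≢m = generic-step X (ℕP.≤∧≢⇒< (ℕP.≮⇒≥ |X|≮m) (|X|≢m ∘ sym))

  antipode-U : ∀ f X → ∣ X ∣ < f → antipodeF f (U m X) ≈ᶜ expected X
  antipode-U (suc f) X |X|<1+f with ∣ X ∣ ℕ.≟ 0
  ... | yes |X|≡0 with ∣ X ∣ ℕP.<? m
  ...   | yes _     = ≈ᶜ-term [] (≈-reflexive (cong sgn (sym |X|≡0))) ≈ᴹ-refl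
  ...   | no  |X|≮m = contradiction (subst (_< m) (sym |X|≡0) 1≤m) |X|≮m
  antipode-U (suc f) X |X|<1+f | no |X|≢0 =
    ≈ᶜ-trans (negC⁺ (concatMap-filter⁺ (λ A → A SubsetP.⊂? X) (allSubsets n) summand≈))
             (recursion-step X (ℕP.n≢0⇒n>0 |X|≢0))
    where
    summand≈ : ∀ A → A ⊂ X → antipodeF f (U m X ∣ʳ A) ⊕ᶜ (U m X / A) ≈ᶜ expected A ⊕ᶜ U (m ∸ ∣ A ∣) (X ─ A)
    summand≈ A A⊂X = ⊕ᶜ⁺ (≈ᶜ-trans (antipodeF-cong f (U-restriction m A X A⊆X))
                                    (antipode-U f A (ℕP.<-≤-trans (SubsetP.p⊂q⇒∣p∣<∣q∣ A⊂X) (ℕP.≤-pred |X|<1+f))))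
                         (U-contraction m A X A⊆X)
      where A⊆X = ⊆⇒⊆ᵇ A X (proj₁ A⊂X)

  expected-⊤ : m ≤ n → expected ⊤ ≈ᶜ ByPair.realize ⊤ (formulaIn ⊤)
  expected-⊤ m≤n with ∣ ⊤ {n} ∣ ℕP.<? m
  ... | yes |⊤|<m = contradiction (subst (m ≤_) (sym (SubsetP.∣⊤∣≡n n)) m≤n) (ℕP.<⇒≱ |⊤|<m)
  ... | no  _     = ≈ᶜ-refl

  formulaIn-⊤≈formulaSum : ByPair.realize ⊤ (formulaIn ⊤) ≈ᶜ formulaSum K n m
  formulaIn-⊤≈formulaSum = begin
    ByPair.realize ⊤ (formulaIn ⊤)
      ≈⟨ ByPair.coeff≗⇒≈ᶜ ⊤ (formulaIn ⊤) summands same-coeff ⟩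
    ByPair.realize ⊤ summands
      ≈⟨ ≈ᵖ⇒≈ᶜ (pointwise (validPairs m)) ⟩
    formulaSum K n m
      ∎
    where
    open ≈ᶜ-Reasoning
    summands : List (ℤ × Pair n)
    summands = map (λ p → -1^ sign (proj₂ p) , p) (validPairs m)
    same-coeff : ∀ l → coeff (formulaIn ⊤) l ≡ coeff summands l
    same-coeff (I , L) rewrite coeff-formulaIn ⊤ (I , L)
                             | coeff-select (λ p → valid? m (proj₁ p) (proj₂ p)) (λ p → -1^ sign (proj₂ p)) (I , L)
                             | ⊆ᵇ-⊤ (I ∪ L) | SubsetP.∣⊤∣≡n n = refl
    pointwise : ∀ ps → ByPair.realize ⊤ (map (λ p → -1^ sign (proj₂ p) , p) ps)
                         ≈ᵖ map (λ p → sgn (sign (proj₂ p)) , term m (proj₁ p) (proj₂ p)) ps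
    pointwise []       = []
    pointwise (p ∷ ps) = (⟦-1^⟧ (sign (proj₂ p)) , ≈ᴹ-refl) ∷ pointwise ps

  S-U≋formulaSum : m ≤ n → S (U m ⊤) ≋ formulaSum K n m
  S-U≋formulaSum m≤n = ≈ᶜ⇒≋ (begin
    S (U m ⊤)
      ≈⟨ antipode-U (suc n) ⊤ (s≤s (ℕP.≤-reflexive (SubsetP.∣⊤∣≡n n))) ⟩
    expected ⊤
      ≈⟨ expected-⊤ m≤n ⟩
    ByPair.realize ⊤ (formulaIn ⊤)
      ≈⟨ formulaIn-⊤≈formulaSum ⟩
    formulaSum K n m
      ∎)
    where open ≈ᶜ-Reasoning

-- Isomorphism invariants

module _ where
  open import Data.Vec using (lookup; tabulate)
  open import Data.Vec.Properties using (tabulate-cong; lookup∘tabulate; lookup-replicate)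
  import Data.Fin.Properties as FinP
  open import Data.Fin.Permutation using (Permutation′; _⟨$⟩ʳ_; _⟨$⟩ˡ_)
  open import Algebra.Properties.CommutativeMonoid.Sum ℕP.+-0-commutativeMonoid using (sum; sum-permute)
  open import Algebra.Properties.Monoid.Sum ℕP.+-0-monoid using (sum-cong-≗)
  open import Relation.Nullary.Decidable using (does-⇔)
  open import Function.Bundles using (mk⇔)

  lookup-ext : {p q : Subset n} → (∀ i → lookup p i ≡ lookup q i) → p ≡ q
  lookup-ext {p = p} {q} h = trans (sym (tabulate∘lookup p)) (trans (tabulate-cong h) (tabulate∘lookup q))

  lookup-⁅⁆ : (a b : Fin n) → lookup ⁅ a ⁆ b ≡ does (a FinP.≟ b)
  lookup-⁅⁆ zero    zero    = refl
  lookup-⁅⁆ zero    (suc b) = lookup-replicate b false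
  lookup-⁅⁆ (suc a) zero    = refl
  lookup-⁅⁆ (suc a) (suc b) = lookup-⁅⁆ a b

  lookup-∁⁅⁆ : (a b : Fin n) → lookup (⊤ ─ ⁅ a ⁆) b ≡ not (does (a FinP.≟ b))
  lookup-∁⁅⁆ zero    zero    = refl
  lookup-∁⁅⁆ zero    (suc b) = lookup-⊤─⊥ b
    where
    lookup-⊤─⊥ : (i : Fin n) → lookup (⊤ {n} ─ ⊥) i ≡ true
    lookup-⊤─⊥ zero    = refl
    lookup-⊤─⊥ (suc i) = lookup-⊤─⊥ i
  lookup-∁⁅⁆ (suc a) zero    = refl
  lookup-∁⁅⁆ (suc a) (suc b) = lookup-∁⁅⁆ a b

  module _ (σ : Permutation′ n) where

    does-σ : ∀ e j → does (e FinP.≟ (σ ⟨$⟩ˡ j)) ≡ does ((σ ⟨$⟩ʳ e) FinP.≟ j)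
    does-σ e j = does-⇔ (mk⇔ (λ e≡ → trans (cong (σ ⟨$⟩ʳ_) e≡) (Perm.inverseʳ σ))
                             (λ σe≡j → trans (sym (Perm.inverseˡ σ)) (cong (σ ⟨$⟩ˡ_) σe≡j)))
                        (e FinP.≟ (σ ⟨$⟩ˡ j)) ((σ ⟨$⟩ʳ e) FinP.≟ j)

    image-⁅⁆ : ∀ e → image σ ⁅ e ⁆ ≡ ⁅ σ ⟨$⟩ʳ e ⁆
    image-⁅⁆ e = lookup-ext λ j → trans (lookup∘tabulate _ j)
      (trans (lookup-⁅⁆ e (σ ⟨$⟩ˡ j)) (trans (does-σ e j) (sym (lookup-⁅⁆ (σ ⟨$⟩ʳ e) j))))

    image-∁⁅⁆ : ∀ e → image σ (⊤ ─ ⁅ e ⁆) ≡ ⊤ ─ ⁅ σ ⟨$⟩ʳ e ⁆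
    image-∁⁅⁆ e = lookup-ext λ j → trans (lookup∘tabulate _ j)
      (trans (lookup-∁⁅⁆ e (σ ⟨$⟩ˡ j)) (trans (cong not (does-σ e j)) (sym (lookup-∁⁅⁆ (σ ⟨$⟩ʳ e) j))))

  ≅⇒sum-rank≡ : {M N : Matroid n} (h : ℕ → ℕ) (Z : Fin n → Subset n) →
                (∀ σ e → image σ (Z e) ≡ Z (σ ⟨$⟩ʳ e)) → ground M ≡ ⊤ → M ≅ N →
                sum (λ e → h (rank M (Z e))) ≡ sum (λ e → h (rank N (Z e)))
  ≅⇒sum-rank≡ {M = M} {N} h Z image-Z ground≡⊤ (σ , _ , rank≡) =
    trans (sum-cong-≗ λ e → cong h (trans (sym (rank≡ (Z e) Z⊆ground)) (cong (rank N) (image-Z σ e))))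
          (sym (sum-permute (λ e → h (rank N (Z e))) σ))
    where
    Z⊆ground : ∀ {Y} → Y ⊆ ground M
    Z⊆ground = subst (_ ⊆_) (sym ground≡⊤) SubsetP.⊆⊤

-- Cancellation-freeness

module _ where
  open import Data.Nat using (_+_; _∸_; _⊓_)
  open import Algebra.Properties.CommutativeMonoid.Sum ℕP.+-0-commutativeMonoid
    using (sum) renaming (∑-distrib-+ to sum-distrib-+)
  open import Algebra.Properties.Monoid.Sum ℕP.+-0-monoid using (sum-cong-≗)

  ∣⊥∩p∣≡0 : (p : Subset n) → ∣ ⊥ ∩ p ∣ ≡ 0
  ∣⊥∩p∣≡0 {n} p = trans (cong ∣_∣ (SubsetP.∩-zeroˡ p)) (SubsetP.∣⊥∣≡0 n)

  sum-∣⁅e⁆∩p∣ : (p : Subset n) → sum (λ e → ∣ ⁅ e ⁆ ∩ p ∣) ≡ ∣ p ∣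
  sum-∣⁅e⁆∩p∣ []          = refl
  sum-∣⁅e⁆∩p∣ (true ∷ p)  rewrite ∣⊥∩p∣≡0 p = cong suc (sum-∣⁅e⁆∩p∣ p)
  sum-∣⁅e⁆∩p∣ (false ∷ p) rewrite ∣⊥∩p∣≡0 p = sum-∣⁅e⁆∩p∣ p

  ∣⁅e⁆∩p∣≤1 : (e : Fin n) (p : Subset n) → ∣ ⁅ e ⁆ ∩ p ∣ ≤ 1
  ∣⁅e⁆∩p∣≤1 e p = ℕP.≤-trans (SubsetP.∣p∩q∣≤∣p∣ ⁅ e ⁆ p) (ℕP.≤-reflexive (SubsetP.∣⁅x⁆∣≡1 e))

  ∣⁅e⁆∩p∣+∣[⊤─⁅e⁆]∩p∣≡∣p∣ : (e : Fin n) (p : Subset n) → ∣ ⁅ e ⁆ ∩ p ∣ + ∣ (⊤ ─ ⁅ e ⁆) ∩ p ∣ ≡ ∣ p ∣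
  ∣⁅e⁆∩p∣+∣[⊤─⁅e⁆]∩p∣≡∣p∣ e p = begin
    ∣ ⁅ e ⁆ ∩ p ∣ + ∣ (⊤ ─ ⁅ e ⁆) ∩ p ∣ ≡⟨ cong₂ (λ P Q → ∣ P ∣ + ∣ Q ∣) (SubsetP.∩-comm ⁅ e ⁆ p) (SubsetP.∩-comm _ p) ⟩
    ∣ p ∩ ⁅ e ⁆ ∣ + ∣ p ∩ (⊤ ─ ⁅ e ⁆) ∣ ≡⟨ ∣Y∩A∣+∣Y∩[X─A]∣≡∣Y∩X∣ p ⁅ e ⁆ ⊤ (⊆ᵇ-⊤ ⁅ e ⁆) ⟩
    ∣ p ∩ ⊤ ∣                           ≡⟨ cong ∣_∣ (SubsetP.∩-identityʳ p) ⟩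
    ∣ p ∣                               ∎
    where open ≡-Reasoning

  m∸[i+q⊓l]≡a : ∀ {m a i q l} → m ≡ a + i + q → q ≤ l → m ∸ (i + q ⊓ l) ≡ a
  m∸[i+q⊓l]≡a {m} {a} {i} {q} {l} m≡a+i+q q≤l = begin
    m ∸ (i + q ⊓ l)   ≡⟨ cong₂ (λ x y → x ∸ (i + y)) m≡a+i+q (ℕP.m≤n⇒m⊓n≡m q≤l) ⟩
    a + i + q ∸ (i + q) ≡⟨ cong (_∸ (i + q)) (ℕP.+-assoc a i q) ⟩
    a + (i + q) ∸ (i + q) ≡⟨ ℕP.m+n∸n≡m a (i + q) ⟩
    a                 ∎
    where open ≡-Reasoning

  module Invariants (m : ℕ) where
    open Terms m

    nonLoops : Matroid n → ℕ
    nonLoops M = sum λ e → rank M ⁅ e ⁆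

    -- e counts exactly when it is a coloop of a matroid of rank m
    coloops : Matroid n → ℕ
    coloops M = sum λ e → m ∸ rank M (⊤ ─ ⁅ e ⁆)

    module _ (I L : Subset n) (V : Valid m I L) where
      private
        |I|<m : ∣ I ∣ < m
        |I|<m = proj₁ (proj₂ V)
        m≤|I|+|L| : m ≤ ∣ I ∣ + ∣ L ∣
        m≤|I|+|L| = proj₁ (proj₂ (proj₂ V))

      nonLoops-term : nonLoops (term m I L) ≡ ∣ I ∣ + ∣ L ∣
      nonLoops-term = begin
        sum (λ e → rank (term m I L) ⁅ e ⁆)
          ≡⟨ sum-cong-≗ (λ e → trans (rank-termIn ⊤ I L ⁅ e ⁆)
               (cong (_+_ ∣ ⁅ e ⁆ ∩ I ∣) (ℕP.m≥n⇒m⊓n≡n (ℕP.≤-trans (∣⁅e⁆∩p∣≤1 e L) (ℕP.m<n⇒0<n∸m |I|<m))))) ⟩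
        sum (λ e → ∣ ⁅ e ⁆ ∩ I ∣ + ∣ ⁅ e ⁆ ∩ L ∣)
          ≡⟨ sum-distrib-+ (λ e → ∣ ⁅ e ⁆ ∩ I ∣) (λ e → ∣ ⁅ e ⁆ ∩ L ∣) ⟩
        sum (λ e → ∣ ⁅ e ⁆ ∩ I ∣) + sum (λ e → ∣ ⁅ e ⁆ ∩ L ∣)
          ≡⟨ cong₂ _+_ (sum-∣⁅e⁆∩p∣ I) (sum-∣⁅e⁆∩p∣ L) ⟩
        ∣ I ∣ + ∣ L ∣
          ∎
        where open ≡-Reasoning

      -- Off the tie |L| > m - |I|, so removing e never lowers the rank of the L-part.
      coloops-term : ∣ I ∣ + ∣ L ∣ ≢ m → coloops (term m I L) ≡ ∣ I ∣
      coloops-term no-tie = trans (sum-cong-≗ coloop-e) (sum-∣⁅e⁆∩p∣ I)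
        where
        q : ℕ
        q = m ∸ ∣ I ∣
        |I|+q≡m : ∣ I ∣ + q ≡ m
        |I|+q≡m = ℕP.m+[n∸m]≡n (ℕP.<⇒≤ |I|<m)
        q<|L| : q < ∣ L ∣
        q<|L| = ℕP.+-cancelˡ-< (∣ I ∣) q (∣ L ∣)
                  (subst (_< ∣ I ∣ + ∣ L ∣) (sym |I|+q≡m) (ℕP.≤∧≢⇒< m≤|I|+|L| (no-tie ∘ sym)))
        coloop-e : ∀ e → m ∸ rank (term m I L) (⊤ ─ ⁅ e ⁆) ≡ ∣ ⁅ e ⁆ ∩ I ∣
        coloop-e e = trans (cong (m ∸_) (rank-termIn ⊤ I L (⊤ ─ ⁅ e ⁆)))
          (m∸[i+q⊓l]≡a (trans (sym |I|+q≡m) (cong (_+ q) (sym (∣⁅e⁆∩p∣+∣[⊤─⁅e⁆]∩p∣≡∣p∣ e I))))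
                       (ℕP.m<1+n⇒m≤n (ℕP.<-≤-trans q<|L| |L|≤1+ℓ)))
          where
          ℓ : ℕ
          ℓ = ∣ (⊤ ─ ⁅ e ⁆) ∩ L ∣
          |L|≤1+ℓ : ∣ L ∣ ≤ suc ℓ
          |L|≤1+ℓ = subst (_≤ suc ℓ) (∣⁅e⁆∩p∣+∣[⊤─⁅e⁆]∩p∣≡∣p∣ e L) (ℕP.+-monoˡ-≤ ℓ (∣⁅e⁆∩p∣≤1 e L))

    cancellationFree : ∀ {n} → CancellationFree {n} m
    cancellationFree {n} I L I′ L′ V V′ term≅term′ = cong (λ k → sgnℤ {n} (n ∸ k + 1)) |L|≡|L′|
      where
      ground≡⊤ : ground (term m I L) ≡ ⊤
      ground≡⊤ = ground-termIn ⊤ I L (⊆ᵇ-⊤ (I ∪ L))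
      invariant : (h : ℕ → ℕ) (Z : Fin n → Subset n) → (∀ σ e → image σ (Z e) ≡ Z (σ Perm.⟨$⟩ʳ e)) →
                  sum (λ e → h (rank (term m I L) (Z e))) ≡ sum (λ e → h (rank (term m I′ L′) (Z e)))
      invariant h Z image-Z = ≅⇒sum-rank≡ {M = term m I L} {N = term m I′ L′} h Z image-Z ground≡⊤ term≅term′
      |I|+|L|≡|I′|+|L′| : ∣ I ∣ + ∣ L ∣ ≡ ∣ I′ ∣ + ∣ L′ ∣
      |I|+|L|≡|I′|+|L′| = begin
        ∣ I ∣ + ∣ L ∣           ≡⟨ nonLoops-term I L V ⟨
        nonLoops (term m I L)   ≡⟨ invariant (λ k → k) ⁅_⁆ image-⁅⁆ ⟩
        nonLoops (term m I′ L′) ≡⟨ nonLoops-term I′ L′ V′ ⟩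
        ∣ I′ ∣ + ∣ L′ ∣         ∎
        where open ≡-Reasoning
      tie-size : ∀ {I L} → Valid m I L → ∣ I ∣ + ∣ L ∣ ≡ m → ∣ L ∣ ≡ 1
      tie-size V tie = proj₁ (proj₂ (proj₂ (proj₂ V)) tie)
      |L|≡|L′| : ∣ L ∣ ≡ ∣ L′ ∣
      |L|≡|L′| with ∣ I ∣ + ∣ L ∣ ℕ.≟ m | ∣ I′ ∣ + ∣ L′ ∣ ℕ.≟ m
      ... | yes tie | yes tie′ = trans (tie-size V tie) (sym (tie-size V′ tie′))
      ... | yes tie | no  ¬tie′ = contradiction (trans (sym |I|+|L|≡|I′|+|L′|) tie) ¬tie′
      ... | no  ¬tie | yes tie′ = contradiction (trans |I|+|L|≡|I′|+|L′| tie′) ¬tie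
      ... | no  ¬tie | no  ¬tie′ = ℕP.+-cancelˡ-≡ (∣ I ∣) (∣ L ∣) (∣ L′ ∣)
                                     (trans |I|+|L|≡|I′|+|L′| (cong (_+ ∣ L′ ∣) (sym |I|≡|I′|)))
        where
        |I|≡|I′| : ∣ I ∣ ≡ ∣ I′ ∣
        |I|≡|I′| = begin
          ∣ I ∣                  ≡⟨ coloops-term I L V ¬tie ⟨
          coloops (term m I L)   ≡⟨ invariant (m ∸_) (λ e → ⊤ ─ ⁅ e ⁆) image-∁⁅⁆ ⟩
          coloops (term m I′ L′) ≡⟨ coloops-term I′ L′ V′ ¬tie′ ⟩
          ∣ I′ ∣                 ∎
          where open ≡-Reasoning

corollary3p16 : ∀ {c ℓ₁ ℓ₂} (K : HeytingField c ℓ₁ ℓ₂) (n m : ℕ) →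
    1 ≤ m → m ≤ n →
    Over._≋_ K n (Over.S K n (U m ⊤)) (formulaSum K n m)
      × CancellationFree {n} m
corollary3p16 K n m 1≤m m≤n = Antipode.S-U≋formulaSum K n m 1≤m m≤n , Invariants.cancellationFree m
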